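{- Let $\Sigma$ be an ordered alphabet and let $w\in\Sigma^n$ be self-minimal. Then $$\mathrm{Lynd}(w)=\frac1n\sum_{d\mid n}\mu\!\left(\frac nd\right)\bigl|\mathcal{C}(w_{(d)})\bigr|.$$
   Context: $\langle x\rangle$ denotes the lexicographically minimal cyclic rotation of $x$; $x$ is self-minimal if $\langle x\rangle=x$. A Lyndon word is a primitive self-minimal word. $\mathrm{Lynd}(w)$ is the number of Lyndon words $x$ of length $|w|$ with $x\le w$ lexicographically. $w_{(d)}$ denotes the prefix of $w$ of length $d$. For a word $v$, $\mathcal{C}(v)=\{x\in\Sigma^{|v|} : \langle x\rangle\le v\}$. $\mu$ is the Möbius function. -}

module Defs where

open import Data.Bool using (Bool; true; false; _∧_; _∨_; not; if_then_else_)
open import Data.Nat using (ℕ; zero; suc; _*_; _/_; _∸_)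
open import Data.Nat.Divisibility using (_∣?_)
open import Data.Nat.Primality using (prime?)
open import Data.Fin using (Fin; toℕ)
open import Data.List using (List; []; _∷_; _++_; take; drop; length; map; filter; upTo; concat; replicate; foldr)
open import Data.Bool.ListAction using (or)
open import Data.List.Properties using (≡-dec)
open import Data.Fin.Properties using () renaming (_≟_ to _≟ᶠ_)
open import Data.Integer using (ℤ; +_; -_; 0ℤ; 1ℤ; -1ℤ) renaming (_+_ to _+ℤ_; _*_ to _*ℤ_)
open import Relation.Nullary.Decidable using (⌊_⌋)
open import Relation.Binary.PropositionalEquality using (_≡_)

-- Ordered alphabet: Fin k with its natural order (toℕ).
Word : ℕ → Set
Word k = List (Fin k)

_<ᴸ_ : ∀ {k} → Fin k → Fin k → Bool
a <ᴸ b = ⌊ suc (toℕ a) Data.Nat.≤? toℕ b ⌋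

_==ᴸ_ : ∀ {k} → Fin k → Fin k → Bool
a ==ᴸ b = ⌊ a ≟ᶠ b ⌋

_==ᵂ_ : ∀ {k} → Word k → Word k → Bool
x ==ᵂ y = ⌊ ≡-dec _≟ᶠ_ x y ⌋

_≤ˡᵉˣ_ : ∀ {k} → Word k → Word k → Bool
[] ≤ˡᵉˣ _ = true
(_ ∷ _) ≤ˡᵉˣ [] = false
(a ∷ x) ≤ˡᵉˣ (b ∷ y) = (a <ᴸ b) ∨ ((a ==ᴸ b) ∧ (x ≤ˡᵉˣ y))

lexMin : ∀ {k} → Word k → Word k → Word k
lexMin x y = if x ≤ˡᵉˣ y then x else y

rotate : ∀ {k} → ℕ → Word k → Word k
rotate i x = drop i x ++ take i x

rotations : ∀ {k} → Word k → List (Word k)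
rotations x = map (λ i → rotate i x) (upTo (length x))

-- ⟨x⟩ : lexicographically minimal cyclic rotation of x
minRot : ∀ {k} → Word k → Word k
minRot x = foldr lexMin x (rotations x)

SelfMinimal : ∀ {k} → Word k → Set
SelfMinimal x = minRot x ≡ x

isSelfMinimal : ∀ {k} → Word k → Bool
isSelfMinimal x = minRot x ==ᵂ x

-- x is primitive: not of the form u^m with m ≥ 2 (|u| = d a proper divisor of |x|)
isPrimitive : ∀ {k} → Word k → Bool
isPrimitive x = not (or (map test (upTo n)))
  where
  n = length x
  test : ℕ → Bool
  test zero = false
  test d@(suc d') = ⌊ d ∣? n ⌋ ∧ not ⌊ d Data.Nat.≟ n ⌋
                    ∧ (x ==ᵂ concat (replicate (n / d) (take d x)))

isLyndon : ∀ {k} → Word k → Bool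
isLyndon x = isPrimitive x ∧ isSelfMinimal x

allWords : (k n : ℕ) → List (Word k)
allWords k zero = [] ∷ []
allWords k (suc n) = concat (map (λ a → map (a ∷_) (allWords k n)) (Data.List.allFin k))

Lynd : ∀ {k} → Word k → ℕ
Lynd {k} w = length (filter (λ x → isLyndon x Data.Bool.≟ true) (filter (λ x → (x ≤ˡᵉˣ w) Data.Bool.≟ true) (allWords k (length w))))

cardC : ∀ {k} → Word k → ℕ
cardC {k} v = length (filter (λ x → (minRot x ≤ˡᵉˣ v) Data.Bool.≟ true) (allWords k (length v)))

-- Möbius function (μ 0 = 0 by convention; never used)
μ : ℕ → ℤ
μ zero = 0ℤ
μ n@(suc _) =
  if or (map (λ d → ⌊ (suc (suc d) * suc (suc d)) ∣? n ⌋) (upTo n))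
  then 0ℤ
  else sign (length (filter (λ p → Data.Nat.Primality.prime? p Relation.Nullary.Decidable.×-dec (p ∣? n)) (upTo (suc n))))
  where
  sign : ℕ → ℤ
  sign zero = 1ℤ
  sign (suc m) = - sign m

sumDivisors : (n : ℕ) → (f : (d : ℕ) → .{{_ : Data.Nat.NonZero d}} → ℤ) → ℤ
sumDivisors n f = foldr _+ℤ_ 0ℤ (map g (upTo n))
  where
  g : ℕ → ℤ
  g d' = if ⌊ suc d' ∣? n ⌋ then f (suc d') else 0ℤ

module Submission where

-- By Möbius inversion it suffices to prove, for every divisor d of n,
--
--     |C(w_(d))| = ∑_{e ∣ d} e · Lynd(w_(e)).                                  (★)
--
-- Group the words x of length d by their minimal rotation y = ⟨x⟩: such a y is self-minimal
-- and has exactly period(y) preimages.  A self-minimal y of period e (so e ∣ d) is ℓ^(d/e)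
-- for a unique Lyndon word ℓ of length e, and conversely.  Finally, because w is
-- self-minimal, ℓ^(d/e) ≤ w_(d) iff ℓ ≤ w_(e).

open import Defs

module FiniteSums where

  open import Data.Bool using (Bool; true; false; if_then_else_)
  open import Data.Empty using (⊥-elim)
  open import Data.Integer using (ℤ; +_; 0ℤ; 1ℤ) renaming (_+_ to _+ℤ_; _*_ to _*ℤ_)
  import Data.Integer.Properties as ℤP
  open import Data.List using (List; []; _∷_; map; filter; length; foldr)
  open import Data.List.Membership.Propositional using (_∈_)
  open import Data.List.Membership.Propositional.Properties using (∈-filter⁺; ∈-filter⁻; ∈-map⁻)
  open import Data.List.Relation.Unary.All as All using ([])
  open import Data.List.Relation.Unary.AllPairs using ([]; _∷_)
  open import Data.List.Relation.Unary.Any using (here; there)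
  open import Data.List.Relation.Unary.Unique.Propositional using (Unique)
  import Data.List.Relation.Unary.Unique.Propositional.Properties as Unique
  open import Data.Product using (_,_)
  open import Function using (_∘_)
  open import Level using (0ℓ)
  open import Relation.Binary.Definitions using (DecidableEquality)
  open import Relation.Binary.PropositionalEquality
  open import Relation.Nullary using (yes; no; does)
  open import Relation.Nullary.Decidable using (¬?)
  open import Relation.Unary using (Pred; Decidable)

  open import Algebra.Properties.CommutativeSemigroup ℤP.+-commutativeSemigroup using (interchange)

  ∑ : {A : Set} → List A → (A → ℤ) → ℤ
  ∑ xs f = foldr _+ℤ_ 0ℤ (map f xs)

  syntax ∑ xs (λ x → e) = ∑[ x ∈ xs ] e

  iverson : Bool → ℤ → ℤ
  iverson b z = if b then z else 0ℤ

  iverson-*ˡ : ∀ b (x y : ℤ) → x *ℤ iverson b y ≡ iverson b (x *ℤ y)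
  iverson-*ˡ true x y = refl
  iverson-*ˡ false x y = ℤP.*-zeroʳ x

  iverson-comm : ∀ a b (z : ℤ) → iverson a (iverson b z) ≡ iverson b (iverson a z)
  iverson-comm true true z = refl
  iverson-comm true false z = refl
  iverson-comm false true z = refl
  iverson-comm false false z = refl

  module _ {A : Set} where

    ∑-cong : (xs : List A) {f g : A → ℤ} → (∀ x → x ∈ xs → f x ≡ g x) → ∑ xs f ≡ ∑ xs g
    ∑-cong [] h = refl
    ∑-cong (x ∷ xs) h = cong₂ _+ℤ_ (h x (here refl)) (∑-cong xs (λ y p → h y (there p)))

    ∑-+ : (xs : List A) (f g : A → ℤ) → ∑[ x ∈ xs ] (f x +ℤ g x) ≡ ∑ xs f +ℤ ∑ xs g
    ∑-+ [] f g = refl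
    ∑-+ (x ∷ xs) f g rewrite ∑-+ xs f g = interchange (f x) (g x) (∑ xs f) (∑ xs g)

    ∑-*ˡ : (xs : List A) (c : ℤ) (f : A → ℤ) → ∑[ x ∈ xs ] (c *ℤ f x) ≡ c *ℤ ∑ xs f
    ∑-*ˡ [] c f = sym (ℤP.*-zeroʳ c)
    ∑-*ˡ (x ∷ xs) c f rewrite ∑-*ˡ xs c f = sym (ℤP.*-distribˡ-+ c (f x) (∑ xs f))

    ∑-zero : (xs : List A) {f : A → ℤ} → (∀ x → x ∈ xs → f x ≡ 0ℤ) → ∑ xs f ≡ 0ℤ
    ∑-zero [] h = refl
    ∑-zero (x ∷ xs) h =
      cong₂ _+ℤ_ (h x (here refl)) (∑-zero xs (λ y p → h y (there p)))

    ∑-filter : {P : Pred A 0ℓ} (P? : Decidable P) (xs : List A) (f : A → ℤ) →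
               ∑ (filter P? xs) f ≡ ∑[ x ∈ xs ] iverson (does (P? x)) (f x)
    ∑-filter P? [] f = refl
    ∑-filter P? (x ∷ xs) f with does (P? x)
    ... | true = cong (f x +ℤ_) (∑-filter P? xs f)
    ... | false = trans (∑-filter P? xs f) (sym (ℤP.+-identityˡ _))

    ∑-one : (xs : List A) → + length xs ≡ ∑[ x ∈ xs ] 1ℤ
    ∑-one [] = refl
    ∑-one (x ∷ xs) = cong (1ℤ +ℤ_) (∑-one xs)

    count≡∑ : {P : Pred A 0ℓ} (P? : Decidable P) (xs : List A) →
              + length (filter P? xs) ≡ ∑[ x ∈ xs ] iverson (does (P? x)) 1ℤ
    count≡∑ P? xs = trans (∑-one (filter P? xs)) (∑-filter P? xs (λ _ → 1ℤ))

    ∑-partition : {P : Pred A 0ℓ} (P? : Decidable P) (xs : List A) (f : A → ℤ) →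
      ∑ xs f ≡ ∑ (filter P? xs) f +ℤ ∑ (filter (¬? ∘ P?) xs) f
    ∑-partition P? xs f = begin
      ∑ xs f
        ≡⟨ ∑-cong xs (λ x _ → split x) ⟩
      ∑[ x ∈ xs ] (iverson (does (P? x)) (f x) +ℤ iverson (does (¬? (P? x))) (f x))
        ≡⟨ ∑-+ xs _ _ ⟩
      ∑[ x ∈ xs ] iverson (does (P? x)) (f x) +ℤ ∑[ x ∈ xs ] iverson (does (¬? (P? x))) (f x)
        ≡⟨ sym (cong₂ _+ℤ_ (∑-filter P? xs f) (∑-filter (¬? ∘ P?) xs f)) ⟩
      ∑ (filter P? xs) f +ℤ ∑ (filter (¬? ∘ P?) xs) f ∎
      where
      open ≡-Reasoning
      split : ∀ x → f x ≡ iverson (does (P? x)) (f x) +ℤ iverson (does (¬? (P? x))) (f x)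
      split x with P? x
      ... | yes _ = sym (ℤP.+-identityʳ (f x))
      ... | no _ = sym (ℤP.+-identityˡ (f x))

  module _ {A B : Set} where

    ∑-map : (h : A → B) (xs : List A) (f : B → ℤ) → ∑ (map h xs) f ≡ ∑ xs (f ∘ h)
    ∑-map h [] f = refl
    ∑-map h (x ∷ xs) f = cong (f (h x) +ℤ_) (∑-map h xs f)

    ∑-swap : (xs : List A) (ys : List B) (h : A → B → ℤ) →
             ∑[ x ∈ xs ] ∑[ y ∈ ys ] h x y ≡ ∑[ y ∈ ys ] ∑[ x ∈ xs ] h x y
    ∑-swap [] ys h = sym (∑-zero ys (λ _ _ → refl))
    ∑-swap (x ∷ xs) ys h rewrite ∑-swap xs ys h = sym (∑-+ ys (h x) (λ y → ∑[ x′ ∈ xs ] h x′ y))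

    map-unique : (f : A → B) (xs : List A) → Unique xs →
      (∀ {x y} → x ∈ xs → y ∈ xs → f x ≡ f y → x ≡ y) → Unique (map f xs)
    map-unique f [] _ _ = []
    map-unique f (x ∷ xs) (x∉ ∷ u) inj =
      All.tabulate fresh ∷ map-unique f xs u (λ a b → inj (there a) (there b))
      where
      fresh : ∀ {z} → z ∈ map f xs → f x ≢ z
      fresh z∈ fx≡z with ∈-map⁻ f z∈
      ... | y , y∈ , refl = All.lookup x∉ y∈ (inj (here refl) (there y∈) fx≡z)

  module SetSum {A : Set} (_≟_ : DecidableEquality A) where

    remove : A → List A → List A
    remove a = filter (λ x → ¬? (x ≟ a))

    ∑-remove : (a : A) (xs : List A) (f : A → ℤ) → Unique xs → a ∈ xs →
               ∑ xs f ≡ f a +ℤ ∑ (remove a xs) f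
    ∑-remove a (x ∷ xs) f (x∉ ∷ u) (here refl) with x ≟ x
    ... | no x≢x = ⊥-elim (x≢x refl)
    ... | yes _ = cong (f x +ℤ_) (sym (trans (∑-filter _ xs f) (∑-cong xs kept)))
      where
      kept : ∀ y → y ∈ xs → iverson (does (¬? (y ≟ x))) (f y) ≡ f y
      kept y y∈ with y ≟ x
      ... | yes refl = ⊥-elim (All.lookup x∉ y∈ refl)
      ... | no _ = refl
    ∑-remove a (x ∷ xs) f (x∉ ∷ u) (there a∈) with x ≟ a
    ... | yes refl = ⊥-elim (All.lookup x∉ a∈ refl)
    ... | no _ = begin
      f x +ℤ ∑ xs f                      ≡⟨ cong (f x +ℤ_) (∑-remove a xs f u a∈) ⟩
      f x +ℤ (f a +ℤ ∑ (remove a xs) f)  ≡⟨ sym (ℤP.+-assoc (f x) _ _) ⟩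
      (f x +ℤ f a) +ℤ ∑ (remove a xs) f  ≡⟨ cong (_+ℤ ∑ (remove a xs) f) (ℤP.+-comm (f x) (f a)) ⟩
      (f a +ℤ f x) +ℤ ∑ (remove a xs) f  ≡⟨ ℤP.+-assoc (f a) _ _ ⟩
      f a +ℤ (f x +ℤ ∑ (remove a xs) f)  ∎
      where open ≡-Reasoning

    ∑-reindex : (xs ys : List A) (f : A → ℤ) → Unique xs → Unique ys →
                (∀ {x} → x ∈ xs → x ∈ ys) → (∀ {x} → x ∈ ys → x ∈ xs) → ∑ xs f ≡ ∑ ys f
    ∑-reindex [] [] f _ _ _ _ = refl
    ∑-reindex [] (y ∷ ys) f _ _ _ ys⊆xs with ys⊆xs (here refl)
    ... | ()
    ∑-reindex (x ∷ xs) ys f (x∉ ∷ u) uy xs⊆ys ys⊆xs =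
      trans (cong (f x +ℤ_) (∑-reindex xs (remove x ys) f u (Unique.filter⁺ _ uy) ⊆rest rest⊆))
            (sym (∑-remove x ys f uy (xs⊆ys (here refl))))
      where
      ⊆rest : ∀ {z} → z ∈ xs → z ∈ remove x ys
      ⊆rest z∈ = ∈-filter⁺ _ (xs⊆ys (there z∈)) (λ { refl → All.lookup x∉ z∈ refl })
      rest⊆ : ∀ {z} → z ∈ remove x ys → z ∈ xs
      rest⊆ z∈ with ∈-filter⁻ _ z∈
      ... | z∈ys , z≢x with ys⊆xs z∈ys
      ... | here refl = ⊥-elim (z≢x refl)
      ... | there p = p

    ∑-select : (xs : List A) (a : A) (f : A → ℤ) → Unique xs → a ∈ xs →
               ∑[ x ∈ xs ] iverson (does (x ≟ a)) (f x) ≡ f a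
    ∑-select xs a f u a∈ = begin
      ∑[ x ∈ xs ] iverson (does (x ≟ a)) (f x)  ≡⟨ sym (∑-filter (_≟ a) xs f) ⟩
      ∑ (filter (_≟ a) xs) f                    ≡⟨ ∑-reindex _ (a ∷ []) f (Unique.filter⁺ _ u) ([] ∷ []) ⊆a a⊆ ⟩
      f a +ℤ 0ℤ                                 ≡⟨ ℤP.+-identityʳ (f a) ⟩
      f a                                       ∎
      where
      open ≡-Reasoning
      ⊆a : ∀ {z} → z ∈ filter (_≟ a) xs → z ∈ a ∷ []
      ⊆a z∈ with ∈-filter⁻ (_≟ a) {xs = xs} z∈
      ... | _ , refl = here refl
      a⊆ : ∀ {z} → z ∈ a ∷ [] → z ∈ filter (_≟ a) xs
      a⊆ (here refl) = ∈-filter⁺ (_≟ a) a∈ refl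

module Möbius where

  open FiniteSums
  open import Data.Bool using (Bool; true; false; T; if_then_else_)
  open import Data.Bool.ListAction using (any)
  open import Data.Empty using (⊥-elim)
  open import Data.Integer using (ℤ; +_; -_; 0ℤ; 1ℤ) renaming (_+_ to _+ℤ_; _*_ to _*ℤ_)
  import Data.Integer.Properties as ℤP
  open import Data.List using (List; _∷_; map; filter; length; upTo)
  open import Data.List.Membership.Propositional using (_∈_; lose)
  open import Data.List.Membership.Propositional.Properties using (∈-filter⁺; ∈-filter⁻; ∈-map⁺; ∈-map⁻; ∈-upTo⁺)
  import Data.List.Relation.Unary.All as All
  open import Data.List.Relation.Unary.AllPairs using (_∷_)
  open import Data.List.Relation.Unary.Any using (here; there; satisfied)
  open import Data.List.Relation.Unary.Any.Properties using (any⁺; any⁻)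
  open import Data.List.Relation.Unary.Unique.Propositional using (Unique)
  import Data.List.Relation.Unary.Unique.Propositional.Properties as Unique
  open import Data.Nat
  open import Data.Nat.Coprimality using (Coprime; coprime-divisor)
  open import Data.Nat.Divisibility
  open import Data.Nat.DivMod using (m/n*n≡m; m*n/n≡m)
  open import Data.Nat.Induction using (<-rec)
  open import Data.Nat.Primality
  open import Data.Nat.Properties
  open import Data.Product using (_×_; _,_; proj₁; proj₂; ∃)
  open import Data.Sum using (inj₁; inj₂)
  open import Function using (_∘_)
  open import Relation.Binary.PropositionalEquality
  open import Relation.Nullary using (Dec; yes; no; ¬_; does)
  open import Relation.Nullary.Decidable using (⌊_⌋; _×-dec_; ¬?; toWitness; fromWitness)

  open SetSum Data.Nat._≟_

  T-ext : ∀ {a b} → (T a → T b) → (T b → T a) → a ≡ b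
  T-ext {false} {false} _ _ = refl
  T-ext {false} {true} _ b⇒a = ⊥-elim (b⇒a _)
  T-ext {true} {false} a⇒b _ = ⊥-elim (a⇒b _)
  T-ext {true} {true} _ _ = refl

  prime≥2 : ∀ {p} → Prime p → 2 ≤ p
  prime≥2 {p} pp = nonTrivial⇒n>1 p {{prime⇒nonTrivial pp}}

  primeFactor : ∀ n → 2 ≤ n → ∃ λ p → Prime p × p ∣ n
  primeFactor = <-rec (λ n → 2 ≤ n → ∃ λ p → Prime p × p ∣ n) step
    where
    step : ∀ n → (∀ {m} → m < n → 2 ≤ m → ∃ λ p → Prime p × p ∣ m) → 2 ≤ n →
           ∃ λ p → Prime p × p ∣ n
    step n@(suc (suc _)) rec _ with prime? n
    ... | yes n-prime = n , n-prime , ∣-refl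
    ... | no ¬prime with ¬prime⇒composite ¬prime
    ... | hasNonTrivialDivisor {d} d<n d∣n with rec d<n (nonTrivial⇒n>1 d)
    ... | p , p-prime , p∣d = p , p-prime , ∣-trans p∣d d∣n
    step 1 _ (s≤s ())

  prime∤⇒coprime : ∀ {p d} → Prime p → ¬ p ∣ d → Coprime d p
  prime∤⇒coprime pp p∤d (i∣d , i∣p) with prime⇒irreducible pp i∣p
  ... | inj₁ i≡1 = i≡1
  ... | inj₂ refl = ⊥-elim (p∤d i∣d)

  prime∣prime : ∀ {p r} → Prime p → Prime r → p ∣ r → p ≡ r
  prime∣prime pp pr p∣r with prime⇒irreducible pr p∣r
  ... | inj₂ p≡r = p≡r
  ... | inj₁ refl = ⊥-elim (¬prime[1] pp)

  divisors : ℕ → List ℕ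
  divisors n = filter (_∣? n) (map suc (upTo n))

  ∈-divisors⁻ : ∀ n {d} → d ∈ divisors n → d ∣ n × 1 ≤ d
  ∈-divisors⁻ n d∈ with ∈-filter⁻ (_∣? n) {xs = map suc (upTo n)} d∈
  ... | d∈′ , d∣n with ∈-map⁻ suc d∈′
  ... | _ , _ , refl = d∣n , s≤s z≤n

  ∈-divisors⁺ : ∀ {n d} → .{{NonZero n}} → 1 ≤ d → d ∣ n → d ∈ divisors n
  ∈-divisors⁺ {n} {suc d} _ d∣n = ∈-filter⁺ (_∣? n) (∈-map⁺ suc (∈-upTo⁺ (∣⇒≤ d∣n))) d∣n

  divisors-unique : ∀ n → Unique (divisors n)
  divisors-unique n = Unique.filter⁺ (_∣? n) (Unique.map⁺ suc-injective (Unique.upTo⁺ n))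

  -- Division made total in the divisor, so no NonZero instance has to travel along.
  _÷_ : ℕ → ℕ → ℕ
  n ÷ zero = 0
  n ÷ suc d = n / suc d

  ÷-* : ∀ {m d} → 1 ≤ d → d ∣ m → (m ÷ d) * d ≡ m
  ÷-* {m} {suc d} _ d∣m = m/n*n≡m d∣m

  ÷-unique : ∀ {m d q} → 1 ≤ d → q * d ≡ m → m ÷ d ≡ q
  ÷-unique {d = suc d} {q} _ refl = m*n/n≡m q (suc d)

  1≤*⇒1≤ : ∀ {a b} → 1 ≤ a * b → 1 ≤ a
  1≤*⇒1≤ {zero} h = h
  1≤*⇒1≤ {suc _} _ = s≤s z≤n

  1≤-* : ∀ {a b} → 1 ≤ a → 1 ≤ b → 1 ≤ a * b
  1≤-* {suc a} {suc b} _ _ = s≤s z≤n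

  ÷-pos : ∀ {m d} → 1 ≤ m → 1 ≤ d → d ∣ m → 1 ≤ m ÷ d
  ÷-pos 1≤m 1≤d d∣m = 1≤*⇒1≤ (subst (1 ≤_) (sym (÷-* 1≤d d∣m)) 1≤m)

  ÷-suc : ∀ {m d} → 1 ≤ m → 1 ≤ d → d ∣ m → m ÷ d ≡ suc (m ÷ d ∸ 1)
  ÷-suc 1≤m 1≤d d∣m = sym (m+[n∸m]≡n (÷-pos 1≤m 1≤d d∣m))

  ÷-∣ : ∀ {m d} → 1 ≤ d → d ∣ m → (m ÷ d) ∣ m
  ÷-∣ {m} {d} 1≤d d∣m = divides d (trans (sym (÷-* 1≤d d∣m)) (*-comm (m ÷ d) d))

  ÷-involutive : ∀ {m c} → 1 ≤ m → 1 ≤ c → c ∣ m → m ÷ (m ÷ c) ≡ c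
  ÷-involutive {m} {c} 1≤m 1≤c c∣m =
    ÷-unique (÷-pos 1≤m 1≤c c∣m) (trans (*-comm c (m ÷ c)) (÷-* 1≤c c∣m))

  -- By its definition in `Defs`, μ(n) = 0 when q² ∣ n for some q ≥ 2, and otherwise
  -- μ(n) = (−1)^(number of prime divisors of n).  These are the two ingredients:
  hasSquareFactor : ℕ → Bool
  hasSquareFactor n = any (λ d → ⌊ (suc (suc d) * suc (suc d)) ∣? n ⌋) (upTo n)

  primeDivisors : ℕ → List ℕ
  primeDivisors n = filter (λ p → prime? p ×-dec (p ∣? n)) (upTo (suc n))

  hasSquareFactor⁻ : ∀ n → T (hasSquareFactor n) → ∃ λ q → 2 ≤ q × q * q ∣ n
  hasSquareFactor⁻ n t with satisfied (any⁻ _ (upTo n) t)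
  ... | d , sq∣n = suc (suc d) , s≤s (s≤s z≤n) , toWitness sq∣n

  hasSquareFactor⁺ : ∀ n q → .{{NonZero n}} → 2 ≤ q → q * q ∣ n → T (hasSquareFactor n)
  hasSquareFactor⁺ n 1 (s≤s ()) _
  hasSquareFactor⁺ n q@(suc (suc d)) _ qq∣n = any⁺ _ (lose (∈-upTo⁺ d<n) (fromWitness qq∣n))
    where
    d<n : d < n
    d<n = ≤-trans (≤-trans (n≤1+n (suc d)) (m≤m*n q q)) (∣⇒≤ qq∣n)

  μ-squareFactor : ∀ {n q} → .{{NonZero n}} → 2 ≤ q → q * q ∣ n → μ n ≡ 0ℤ
  μ-squareFactor {suc a} {q} 2≤q qq∣n with hasSquareFactor (suc a) | hasSquareFactor⁺ (suc a) q 2≤q qq∣n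
  ... | true | _ = refl

  square∣p*m : ∀ {p m q} → Prime p → ¬ p ∣ m → 2 ≤ q → q * q ∣ p * m →
               ∃ λ r → 2 ≤ r × r * r ∣ m
  square∣p*m {p} {m} {q} pp p∤m 2≤q qq∣pm with primeFactor q 2≤q
  ... | r , pr , r∣q with p ∣? (r * r)
  ... | no p∤rr = r , prime≥2 pr , coprime-divisor (prime∤⇒coprime pp p∤rr) rr∣pm
    where rr∣pm = ∣-trans (*-pres-∣ r∣q r∣q) qq∣pm
  ... | yes p∣rr = ⊥-elim (p∤m (*-cancelˡ-∣ p {{prime⇒nonZero pp}} pp∣pm))
    where
    p≡r : p ≡ r
    p≡r with euclidsLemma r r pp p∣rr
    ... | inj₁ p∣r = prime∣prime pp pr p∣r
    ... | inj₂ p∣r = prime∣prime pp pr p∣r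
    pp∣pm : p * p ∣ p * m
    pp∣pm = subst (λ x → x * x ∣ p * m) (sym p≡r) (∣-trans (*-pres-∣ r∣q r∣q) qq∣pm)

  hasSquareFactor-p* : ∀ {p m} → Prime p → ¬ p ∣ m → .{{NonZero m}} →
                       hasSquareFactor (p * m) ≡ hasSquareFactor m
  hasSquareFactor-p* {p} {m} pp p∤m = T-ext fromPM toPM
    where
    instance _ = m*n≢0 p m {{prime⇒nonZero pp}}
    fromPM : T (hasSquareFactor (p * m)) → T (hasSquareFactor m)
    fromPM t with hasSquareFactor⁻ (p * m) t
    ... | q , 2≤q , qq∣pm with square∣p*m pp p∤m 2≤q qq∣pm
    ... | r , 2≤r , rr∣m = hasSquareFactor⁺ m r 2≤r rr∣m
    toPM : T (hasSquareFactor m) → T (hasSquareFactor (p * m))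
    toPM t with hasSquareFactor⁻ m t
    ... | q , 2≤q , qq∣m = hasSquareFactor⁺ (p * m) q 2≤q (∣-trans qq∣m (n∣m*n p))

  ∈-primeDivisors⁻ : ∀ {n x} → x ∈ primeDivisors n → Prime x × x ∣ n
  ∈-primeDivisors⁻ {n} x∈ = proj₂ (∈-filter⁻ (λ x → prime? x ×-dec (x ∣? n)) {xs = upTo (suc n)} x∈)

  ∈-primeDivisors⁺ : ∀ {n x} → .{{NonZero n}} → Prime x → x ∣ n → x ∈ primeDivisors n
  ∈-primeDivisors⁺ {n} px x∣n =
    ∈-filter⁺ (λ x → prime? x ×-dec (x ∣? n)) (∈-upTo⁺ (s≤s (∣⇒≤ x∣n))) (px , x∣n)

  primeDivisors-unique : ∀ n → Unique (primeDivisors n)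
  primeDivisors-unique n = Unique.filter⁺ (λ x → prime? x ×-dec (x ∣? n)) (Unique.upTo⁺ (suc n))

  primeDivisors-p* : ∀ {p m} → Prime p → ¬ p ∣ m → .{{NonZero m}} →
                     length (primeDivisors (p * m)) ≡ suc (length (primeDivisors m))
  primeDivisors-p* {p} {m} pp p∤m = ℤP.+-injective (begin
    + length (primeDivisors (p * m))   ≡⟨ ∑-one (primeDivisors (p * m)) ⟩
    ∑[ _ ∈ primeDivisors (p * m) ] 1ℤ  ≡⟨ ∑-reindex _ _ _ (primeDivisors-unique (p * m)) unique ⊆p∷ p∷⊆ ⟩
    ∑[ _ ∈ p ∷ primeDivisors m ] 1ℤ    ≡⟨ sym (∑-one (p ∷ primeDivisors m)) ⟩
    + length (p ∷ primeDivisors m)     ∎)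
    where
    open ≡-Reasoning
    instance _ = prime⇒nonZero pp
    instance _ = m*n≢0 p m
    unique : Unique (p ∷ primeDivisors m)
    unique = All.tabulate (λ x∈ p≡x → p∤m (subst (_∣ m) (sym p≡x) (proj₂ (∈-primeDivisors⁻ x∈))))
           ∷ primeDivisors-unique m
    ⊆p∷ : ∀ {x} → x ∈ primeDivisors (p * m) → x ∈ p ∷ primeDivisors m
    ⊆p∷ {x} x∈ with ∈-primeDivisors⁻ {p * m} x∈
    ... | px , x∣pm with euclidsLemma p m px x∣pm
    ... | inj₁ x∣p = here (prime∣prime px pp x∣p)
    ... | inj₂ x∣m = there (∈-primeDivisors⁺ px x∣m)
    p∷⊆ : ∀ {x} → x ∈ p ∷ primeDivisors m → x ∈ primeDivisors (p * m)
    p∷⊆ (here refl) = ∈-primeDivisors⁺ pp (m∣m*n m)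
    p∷⊆ (there x∈) with ∈-primeDivisors⁻ {m} x∈
    ... | px , x∣m = ∈-primeDivisors⁺ px (∣-trans x∣m (n∣m*n p))

  μ-unfold : ∀ a b → hasSquareFactor (suc a) ≡ hasSquareFactor (suc b) →
             length (primeDivisors (suc a)) ≡ suc (length (primeDivisors (suc b))) →
             μ (suc a) ≡ - μ (suc b)
  μ-unfold a b sq≡ count≡ with hasSquareFactor (suc b)
  ... | true rewrite sq≡ = refl
  ... | false rewrite sq≡ | count≡ = refl

  μ-p* : ∀ {p m} → Prime p → ¬ p ∣ m → .{{NonZero m}} → μ (p * m) ≡ - μ m
  μ-p* {p} {suc b} pp p∤m = unfold (p * suc b) refl
    where
    unfold : ∀ x → x ≡ p * suc b → μ x ≡ - μ (suc b)
    unfold zero 0≡pm with m*n≡0⇒m≡0∨n≡0 p (sym 0≡pm)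
    ... | inj₁ refl = ⊥-elim (¬prime[0] pp)
    unfold (suc a) x≡pm = μ-unfold a b (trans (cong hasSquareFactor x≡pm) (hasSquareFactor-p* pp p∤m))
                                       (trans (cong (length ∘ primeDivisors) x≡pm) (primeDivisors-p* pp p∤m))

  -- The divisors of n split into those prime to p
  -- (`coprimeDivisors`), those exactly divisible by p (which are p·e for e prime to p,
  -- and contribute −μ(e)), and those divisible by p² (where μ vanishes).
  module MöbiusSum (n p : ℕ) (p-prime : Prime p) (p∣n : p ∣ n) .{{_ : NonZero n}} where

    private instance _ = prime⇒nonZero p-prime

    exactly? : ∀ d → Dec (p ∣ d × ¬ p * p ∣ d)
    exactly? d = p ∣? d ×-dec ¬? (p * p ∣? d)

    coprimeDivisors : List ℕ
    coprimeDivisors = filter (¬? ∘ (p ∣?_)) (divisors n)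

    ∑-multiples≡∑-exact : ∑ (filter (p ∣?_) (divisors n)) μ ≡ ∑ (filter exactly? (divisors n)) μ
    ∑-multiples≡∑-exact = begin
      ∑ (filter (p ∣?_) (divisors n)) μ                          ≡⟨ ∑-filter (p ∣?_) (divisors n) μ ⟩
      ∑[ d ∈ divisors n ] iverson (does (p ∣? d)) (μ d)          ≡⟨ ∑-cong (divisors n) squareTermsVanish ⟩
      ∑[ d ∈ divisors n ] iverson (does (exactly? d)) (μ d)      ≡⟨ sym (∑-filter exactly? (divisors n) μ) ⟩
      ∑ (filter exactly? (divisors n)) μ                         ∎
      where
      open ≡-Reasoning
      squareTermsVanish : ∀ d → d ∈ divisors n →
        iverson (does (p ∣? d)) (μ d) ≡ iverson (does (exactly? d)) (μ d)
      squareTermsVanish d d∈ with p ∣? d | p * p ∣? d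
      ... | no _ | _ = refl
      ... | yes _ | no _ = refl
      ... | yes _ | yes pp∣d =
        μ-squareFactor {{>-nonZero (proj₂ (∈-divisors⁻ n d∈))}} (prime≥2 p-prime) pp∣d

    -- d ↦ p·d is a bijection from coprimeDivisors onto the exact multiples of p.
    exact⊆p*coprime : ∀ {d} → d ∈ filter exactly? (divisors n) → d ∈ map (p *_) coprimeDivisors
    exact⊆p*coprime d∈ with ∈-filter⁻ exactly? {xs = divisors n} d∈
    ... | d∈′ , divides e refl , ¬pp∣ep with ∈-divisors⁻ n d∈′
    ... | ep∣n , 1≤ep = subst (_∈ map (p *_) coprimeDivisors) (*-comm p e)
      (∈-map⁺ (p *_) (∈-filter⁺ (¬? ∘ (p ∣?_))
        (∈-divisors⁺ (1≤*⇒1≤ 1≤ep) (∣-trans (n∣m*n p) (subst (_∣ n) (*-comm e p) ep∣n)))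
        λ p∣e → ¬pp∣ep (subst (p * p ∣_) (*-comm p e) (*-monoʳ-∣ p p∣e))))

    p*coprime⊆exact : ∀ {d} → d ∈ map (p *_) coprimeDivisors → d ∈ filter exactly? (divisors n)
    p*coprime⊆exact d∈ with ∈-map⁻ (p *_) d∈
    ... | e , e∈ , refl with ∈-filter⁻ (¬? ∘ (p ∣?_)) {xs = divisors n} e∈
    ... | e∈′ , p∤e with ∈-divisors⁻ n e∈′
    ... | e∣n , 1≤e =
      ∈-filter⁺ exactly? (∈-divisors⁺ (1≤-* (≤-trans (s≤s z≤n) (prime≥2 p-prime)) 1≤e) pe∣n)
        (m∣m*n e , λ pp∣pe → p∤e (*-cancelˡ-∣ p pp∣pe))
      where
      n≡p*q : n ≡ p * quotient p∣n
      n≡p*q = m∣n⇒n≡m*quotient p∣n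
      pe∣n : p * e ∣ n
      pe∣n = subst (p * e ∣_) (sym n≡p*q)
        (*-monoʳ-∣ p (coprime-divisor (prime∤⇒coprime p-prime p∤e) (subst (e ∣_) n≡p*q e∣n)))

    ∑-exact≡-∑-coprime : ∑ (filter exactly? (divisors n)) μ ≡ ∑[ d ∈ coprimeDivisors ] (- μ d)
    ∑-exact≡-∑-coprime = begin
      ∑ (filter exactly? (divisors n)) μ
        ≡⟨ ∑-reindex _ _ μ (Unique.filter⁺ exactly? (divisors-unique n))
             (Unique.map⁺ (*-cancelˡ-≡ _ _ p) (Unique.filter⁺ (¬? ∘ (p ∣?_)) (divisors-unique n)))
             exact⊆p*coprime p*coprime⊆exact ⟩
      ∑ (map (p *_) coprimeDivisors) μ
        ≡⟨ ∑-map (p *_) coprimeDivisors μ ⟩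
      ∑[ d ∈ coprimeDivisors ] μ (p * d)
        ≡⟨ ∑-cong coprimeDivisors flip ⟩
      ∑[ d ∈ coprimeDivisors ] (- μ d) ∎
      where
      open ≡-Reasoning
      flip : ∀ d → d ∈ coprimeDivisors → μ (p * d) ≡ - μ d
      flip d d∈ with ∈-filter⁻ (¬? ∘ (p ∣?_)) {xs = divisors n} d∈
      ... | d∈′ , p∤d = μ-p* p-prime p∤d {{>-nonZero (proj₂ (∈-divisors⁻ n d∈′))}}

    ∑-μ≡0 : ∑ (divisors n) μ ≡ 0ℤ
    ∑-μ≡0 = begin
      ∑ (divisors n) μ
        ≡⟨ ∑-partition (p ∣?_) (divisors n) μ ⟩
      ∑ (filter (p ∣?_) (divisors n)) μ +ℤ ∑ coprimeDivisors μ
        ≡⟨ cong (_+ℤ ∑ coprimeDivisors μ) (trans ∑-multiples≡∑-exact ∑-exact≡-∑-coprime) ⟩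
      ∑[ d ∈ coprimeDivisors ] (- μ d) +ℤ ∑ coprimeDivisors μ
        ≡⟨ sym (∑-+ coprimeDivisors _ _) ⟩
      ∑[ d ∈ coprimeDivisors ] (- μ d +ℤ μ d)
        ≡⟨ ∑-zero coprimeDivisors (λ d _ → ℤP.+-inverseˡ (μ d)) ⟩
      0ℤ ∎
      where open ≡-Reasoning

  ∑-μ : ∀ m → 1 ≤ m → ∑ (divisors m) μ ≡ iverson (does (m ≟ 1)) 1ℤ
  ∑-μ 1 _ = refl
  ∑-μ m@(suc (suc _)) _ with primeFactor m (s≤s (s≤s z≤n))
  ... | p , p-prime , p∣m = MöbiusSum.∑-μ≡0 m p p-prime p∣m

  module Multiples (n e : ℕ) (1≤n : 1 ≤ n) (e∈ : e ∈ divisors n) where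

    private
      e∣n : e ∣ n
      e∣n = proj₁ (∈-divisors⁻ n e∈)
      1≤e : 1 ≤ e
      1≤e = proj₂ (∈-divisors⁻ n e∈)
      m = n ÷ e
      m*e≡n : m * e ≡ n
      m*e≡n = ÷-* 1≤e e∣n
      1≤m : 1 ≤ m
      1≤m = ÷-pos 1≤n 1≤e e∣n
      instance _ = >-nonZero 1≤n
      instance _ = >-nonZero 1≤m
      instance _ = >-nonZero 1≤e

    multiples⊆ : ∀ {d} → d ∈ filter (e ∣?_) (divisors n) → d ∈ map (e *_) (divisors m)
    multiples⊆ d∈ with ∈-filter⁻ (e ∣?_) {xs = divisors n} d∈
    ... | d∈′ , divides c refl with ∈-divisors⁻ n d∈′
    ... | ce∣n , 1≤ce = subst (_∈ map (e *_) (divisors m)) (*-comm e c)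
      (∈-map⁺ (e *_) (∈-divisors⁺ (1≤*⇒1≤ 1≤ce) (*-cancelʳ-∣ e (subst (c * e ∣_) (sym m*e≡n) ce∣n))))

    ⊆multiples : ∀ {d} → d ∈ map (e *_) (divisors m) → d ∈ filter (e ∣?_) (divisors n)
    ⊆multiples d∈ with ∈-map⁻ (e *_) d∈
    ... | c , c∈ , refl with ∈-divisors⁻ m c∈
    ... | c∣m , 1≤c = ∈-filter⁺ (e ∣?_)
      (∈-divisors⁺ (1≤-* 1≤e 1≤c) (subst (e * c ∣_) (trans (*-comm e m) m*e≡n) (*-monoʳ-∣ e c∣m)))
      (m∣m*n c)

    ÷-e* : ∀ c → c ∈ divisors m → n ÷ (e * c) ≡ m ÷ c
    ÷-e* c c∈ with ∈-divisors⁻ m c∈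
    ... | c∣m , 1≤c = ÷-unique (1≤-* 1≤e 1≤c) (begin
      (m ÷ c) * (e * c)  ≡⟨ cong ((m ÷ c) *_) (*-comm e c) ⟩
      (m ÷ c) * (c * e)  ≡⟨ sym (*-assoc (m ÷ c) c e) ⟩
      (m ÷ c) * c * e    ≡⟨ cong (_* e) (÷-* 1≤c c∣m) ⟩
      m * e              ≡⟨ m*e≡n ⟩
      n                  ∎)
      where open ≡-Reasoning

    ∑-multiples : (f : ℕ → ℤ) →
      ∑[ d ∈ filter (e ∣?_) (divisors n) ] f (n ÷ d) ≡ ∑[ c ∈ divisors m ] f (m ÷ c)
    ∑-multiples f = begin
      ∑[ d ∈ filter (e ∣?_) (divisors n) ] f (n ÷ d)
        ≡⟨ ∑-reindex _ _ _ (Unique.filter⁺ (e ∣?_) (divisors-unique n))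
             (Unique.map⁺ (*-cancelˡ-≡ _ _ e) (divisors-unique m)) multiples⊆ ⊆multiples ⟩
      ∑[ d ∈ map (e *_) (divisors m) ] f (n ÷ d)
        ≡⟨ ∑-map (e *_) (divisors m) _ ⟩
      ∑[ c ∈ divisors m ] f (n ÷ (e * c))
        ≡⟨ ∑-cong (divisors m) (λ c c∈ → cong f (÷-e* c c∈)) ⟩
      ∑[ c ∈ divisors m ] f (m ÷ c) ∎
      where open ≡-Reasoning

  ∑-complementary : ∀ m → 1 ≤ m → (f : ℕ → ℤ) → ∑[ c ∈ divisors m ] f (m ÷ c) ≡ ∑ (divisors m) f
  ∑-complementary m 1≤m f = begin
    ∑[ c ∈ divisors m ] f (m ÷ c)  ≡⟨ sym (∑-map (m ÷_) (divisors m) f) ⟩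
    ∑ (map (m ÷_) (divisors m)) f  ≡⟨ ∑-reindex _ _ f unique (divisors-unique m) image⊆ ⊆image ⟩
    ∑ (divisors m) f               ∎
    where
    open ≡-Reasoning
    instance _ = >-nonZero 1≤m
    involutive : ∀ {c} → c ∈ divisors m → m ÷ (m ÷ c) ≡ c
    involutive c∈ = ÷-involutive 1≤m (proj₂ (∈-divisors⁻ m c∈)) (proj₁ (∈-divisors⁻ m c∈))
    unique : Unique (map (m ÷_) (divisors m))
    unique = map-unique (m ÷_) (divisors m) (divisors-unique m)
      (λ x∈ y∈ eq → trans (sym (involutive x∈)) (trans (cong (m ÷_) eq) (involutive y∈)))
    complement∈ : ∀ {c} → c ∈ divisors m → m ÷ c ∈ divisors m
    complement∈ c∈ with ∈-divisors⁻ m c∈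
    ... | c∣m , 1≤c = ∈-divisors⁺ (÷-pos 1≤m 1≤c c∣m) (÷-∣ 1≤c c∣m)
    image⊆ : ∀ {d} → d ∈ map (m ÷_) (divisors m) → d ∈ divisors m
    image⊆ d∈ with ∈-map⁻ (m ÷_) d∈
    ... | c , c∈ , refl = complement∈ c∈
    ⊆image : ∀ {d} → d ∈ divisors m → d ∈ map (m ÷_) (divisors m)
    ⊆image d∈ = subst (_∈ map (m ÷_) (divisors m)) (involutive d∈) (∈-map⁺ (m ÷_) (complement∈ d∈))

  ∑-μ-multiples : ∀ n e → 1 ≤ n → e ∈ divisors n →
    ∑[ d ∈ filter (e ∣?_) (divisors n) ] μ (n ÷ d) ≡ iverson (does (e ≟ n)) 1ℤ
  ∑-μ-multiples n e 1≤n e∈ = begin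
    ∑[ d ∈ filter (e ∣?_) (divisors n) ] μ (n ÷ d)  ≡⟨ Multiples.∑-multiples n e 1≤n e∈ μ ⟩
    ∑[ c ∈ divisors m ] μ (m ÷ c)                   ≡⟨ ∑-complementary m 1≤m μ ⟩
    ∑ (divisors m) μ                                ≡⟨ ∑-μ m 1≤m ⟩
    iverson (does (m ≟ 1)) 1ℤ
      ≡⟨ cong (λ b → iverson b 1ℤ) (dec-≡ (m ≟ 1) (e ≟ n) m≡1⇒e≡n e≡n⇒m≡1) ⟩
    iverson (does (e ≟ n)) 1ℤ ∎
    where
    open ≡-Reasoning
    e∣n : e ∣ n
    e∣n = proj₁ (∈-divisors⁻ n e∈)
    1≤e : 1 ≤ e
    1≤e = proj₂ (∈-divisors⁻ n e∈)
    m = n ÷ e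
    1≤m : 1 ≤ m
    1≤m = ÷-pos 1≤n 1≤e e∣n
    dec-≡ : ∀ {P Q : Set} (p? : Dec P) (q? : Dec Q) → (P → Q) → (Q → P) → does p? ≡ does q?
    dec-≡ (yes _) (yes _) _ _ = refl
    dec-≡ (no _) (no _) _ _ = refl
    dec-≡ (yes p) (no ¬q) p⇒q _ = ⊥-elim (¬q (p⇒q p))
    dec-≡ (no ¬p) (yes q) _ q⇒p = ⊥-elim (¬p (q⇒p q))
    m≡1⇒e≡n : m ≡ 1 → e ≡ n
    m≡1⇒e≡n m≡1 = trans (sym (*-identityˡ e)) (trans (cong (_* e) (sym m≡1)) (÷-* 1≤e e∣n))
    e≡n⇒m≡1 : e ≡ n → m ≡ 1
    e≡n⇒m≡1 refl = ÷-unique 1≤e (*-identityˡ e)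

  ∑-divisors-of-divisor : ∀ n d → 1 ≤ n → d ∈ divisors n → (F : ℕ → ℤ) →
    ∑ (divisors d) F ≡ ∑[ e ∈ divisors n ] iverson (does (e ∣? d)) (F e)
  ∑-divisors-of-divisor n d 1≤n d∈ F =
    trans (∑-reindex (divisors d) (filter (_∣? d) (divisors n)) F
            (divisors-unique d) (Unique.filter⁺ (_∣? d) (divisors-unique n)) ⊆filter filter⊆)
          (∑-filter (_∣? d) (divisors n) F)
    where
    instance _ = >-nonZero 1≤n
    instance _ = >-nonZero (proj₂ (∈-divisors⁻ n d∈))
    ⊆filter : ∀ {e} → e ∈ divisors d → e ∈ filter (_∣? d) (divisors n)
    ⊆filter e∈ with ∈-divisors⁻ d e∈
    ... | e∣d , 1≤e = ∈-filter⁺ (_∣? d) (∈-divisors⁺ 1≤e (∣-trans e∣d (proj₁ (∈-divisors⁻ n d∈)))) e∣d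
    filter⊆ : ∀ {e} → e ∈ filter (_∣? d) (divisors n) → e ∈ divisors d
    filter⊆ e∈ with ∈-filter⁻ (_∣? d) {xs = divisors n} e∈
    ... | e∈′ , e∣d = ∈-divisors⁺ (proj₂ (∈-divisors⁻ n e∈′)) e∣d

  möbiusInversion : ∀ n → 1 ≤ n → (F G : ℕ → ℤ) → (∀ d → d ∈ divisors n → G d ≡ ∑ (divisors d) F) →
                    ∑[ d ∈ divisors n ] (μ (n ÷ d) *ℤ G d) ≡ F n
  möbiusInversion n 1≤n F G G≡∑F = begin
    ∑[ d ∈ D ] (μ (n ÷ d) *ℤ G d)                                   ≡⟨ ∑-cong D expand ⟩
    ∑[ d ∈ D ] ∑[ e ∈ D ] iverson (does (e ∣? d)) (F e *ℤ μ (n ÷ d)) ≡⟨ ∑-swap D D _ ⟩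
    ∑[ e ∈ D ] ∑[ d ∈ D ] iverson (does (e ∣? d)) (F e *ℤ μ (n ÷ d)) ≡⟨ ∑-cong D collapse ⟩
    ∑[ e ∈ D ] iverson (does (e ≟ n)) (F e)                          ≡⟨ ∑-select D n F (divisors-unique n) n∈D ⟩
    F n                                                              ∎
    where
    open ≡-Reasoning
    D = divisors n
    n∈D : n ∈ D
    n∈D = ∈-divisors⁺ {{>-nonZero 1≤n}} 1≤n ∣-refl
    expand : ∀ d → d ∈ D → μ (n ÷ d) *ℤ G d ≡ ∑[ e ∈ D ] iverson (does (e ∣? d)) (F e *ℤ μ (n ÷ d))
    expand d d∈ = begin
      μ (n ÷ d) *ℤ G d
        ≡⟨ cong (μ (n ÷ d) *ℤ_) (trans (G≡∑F d d∈) (∑-divisors-of-divisor n d 1≤n d∈ F)) ⟩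
      μ (n ÷ d) *ℤ ∑[ e ∈ D ] iverson (does (e ∣? d)) (F e)
        ≡⟨ sym (∑-*ˡ D (μ (n ÷ d)) _) ⟩
      ∑[ e ∈ D ] (μ (n ÷ d) *ℤ iverson (does (e ∣? d)) (F e))
        ≡⟨ ∑-cong D (λ e _ → trans (iverson-*ˡ (does (e ∣? d)) (μ (n ÷ d)) (F e))
                                    (cong (iverson _) (ℤP.*-comm (μ (n ÷ d)) (F e)))) ⟩
      ∑[ e ∈ D ] iverson (does (e ∣? d)) (F e *ℤ μ (n ÷ d)) ∎
    collapse : ∀ e → e ∈ D → ∑[ d ∈ D ] iverson (does (e ∣? d)) (F e *ℤ μ (n ÷ d)) ≡ iverson (does (e ≟ n)) (F e)
    collapse e e∈ = begin
      ∑[ d ∈ D ] iverson (does (e ∣? d)) (F e *ℤ μ (n ÷ d))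
        ≡⟨ ∑-cong D (λ d _ → sym (iverson-*ˡ (does (e ∣? d)) (F e) (μ (n ÷ d)))) ⟩
      ∑[ d ∈ D ] (F e *ℤ iverson (does (e ∣? d)) (μ (n ÷ d)))
        ≡⟨ ∑-*ˡ D (F e) _ ⟩
      F e *ℤ ∑[ d ∈ D ] iverson (does (e ∣? d)) (μ (n ÷ d))
        ≡⟨ cong (F e *ℤ_) (trans (sym (∑-filter (e ∣?_) D _)) (∑-μ-multiples n e 1≤n e∈)) ⟩
      F e *ℤ iverson (does (e ≟ n)) 1ℤ
        ≡⟨ iverson-*ˡ (does (e ≟ n)) (F e) 1ℤ ⟩
      iverson (does (e ≟ n)) (F e *ℤ 1ℤ)
        ≡⟨ cong (iverson _) (ℤP.*-identityʳ (F e)) ⟩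
      iverson (does (e ≟ n)) (F e) ∎

  sumDivisors≡∑ : ∀ n (f : (d : ℕ) → .{{NonZero d}} → ℤ) (h : ℕ → ℤ) → (∀ d → f (suc d) ≡ h (suc d)) →
                  sumDivisors n f ≡ ∑ (divisors n) h
  sumDivisors≡∑ n f h f≡h = begin
    sumDivisors n f                                          ≡⟨ ∑-cong (upTo n) (λ d _ → term d) ⟩
    ∑[ d ∈ upTo n ] iverson (does (suc d ∣? n)) (h (suc d))  ≡⟨ sym (∑-map suc (upTo n) _) ⟩
    ∑[ d ∈ map suc (upTo n) ] iverson (does (d ∣? n)) (h d)  ≡⟨ sym (∑-filter (_∣? n) (map suc (upTo n)) h) ⟩
    ∑ (divisors n) h                                         ∎
    where
    open ≡-Reasoning
    term : ∀ d → (if ⌊ suc d ∣? n ⌋ then f (suc d) else 0ℤ) ≡ iverson (does (suc d ∣? n)) (h (suc d))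
    term d = trans (⌊⌋≡does (suc d ∣? n)) (cong (iverson (does (suc d ∣? n))) (f≡h d))
      where
      ⌊⌋≡does : ∀ {P : Set} (p? : Dec P) → (if ⌊ p? ⌋ then f (suc d) else 0ℤ) ≡ iverson (does p?) (f (suc d))
      ⌊⌋≡does (yes _) = refl
      ⌊⌋≡does (no _) = refl

module Words where

  open import Data.Bool using (true; false; not; T)
  open import Data.Bool.Properties using (T-∧)
  open import Data.Empty using (⊥; ⊥-elim)
  open import Data.Fin using (Fin; toℕ)
  import Data.Fin.Properties as FinP
  open import Data.List using (List; []; _∷_; _++_; take; drop; length; upTo; foldr; concat; replicate)
  open import Data.List.Membership.Propositional using (_∈_; lose)
  open import Data.List.Membership.Propositional.Properties using (∈-map⁻; ∈-map⁺; ∈-upTo⁻; ∈-upTo⁺)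
  open import Data.List.Properties
    using (length-++; ++-assoc; ++-identityʳ; take++drop≡id; length-drop; drop-drop; take-all; drop-all; take-[]; ++-cancelˡ; ≡-dec)
  open import Data.List.Relation.Unary.Any using (here; there; satisfied)
  open import Data.List.Relation.Unary.Any.Properties using (any⁺; any⁻)
  open import Data.Nat
  open import Data.Nat.Divisibility using (_∣_; _∣?_; m%n≡0⇒n∣m; ∣⇒≤)
  open import Data.Nat.DivMod using (_%_; m<n⇒m%n≡m; m≤n⇒[n∸m]%m≡n%m; m%n<n; m/n*n≡m)
  open import Data.Nat.Properties
  open import Data.Product using (_×_; _,_; proj₁; proj₂; ∃)
  open import Data.Sum using (_⊎_; inj₁; inj₂)
  open import Function using (_∘_; Equivalence)
  open import Relation.Binary.Definitions using (tri<; tri≈; tri>)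
  open import Relation.Binary.PropositionalEquality
  open import Relation.Nullary using (Dec; yes; no; ¬_)
  open import Relation.Nullary.Decidable using (⌊_⌋; toWitness; fromWitness; toWitnessFalse; fromWitnessFalse)

  module _ {A : Set} where

    take-++ˡ : ∀ n (xs ys : List A) → n ≤ length xs → take n (xs ++ ys) ≡ take n xs
    take-++ˡ zero xs ys _ = refl
    take-++ˡ (suc n) (x ∷ xs) ys (s≤s h) = cong (x ∷_) (take-++ˡ n xs ys h)

    drop-++ˡ : ∀ n (xs ys : List A) → n ≤ length xs → drop n (xs ++ ys) ≡ drop n xs ++ ys
    drop-++ˡ zero xs ys _ = refl
    drop-++ˡ (suc n) (x ∷ xs) ys (s≤s h) = drop-++ˡ n xs ys h

    take-length-++ : (xs ys : List A) → take (length xs) (xs ++ ys) ≡ xs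
    take-length-++ [] ys = refl
    take-length-++ (x ∷ xs) ys = cong (x ∷_) (take-length-++ xs ys)

    take-+ : ∀ i j (xs : List A) → take (i + j) xs ≡ take i xs ++ take j (drop i xs)
    take-+ zero j xs = refl
    take-+ (suc i) j [] = sym (take-[] j)
    take-+ (suc i) j (x ∷ xs) = cong (x ∷_) (take-+ i j xs)

    length-take≤ : ∀ i (xs : List A) → i ≤ length xs → length (take i xs) ≡ i
    length-take≤ zero xs _ = refl
    length-take≤ (suc i) (x ∷ xs) (s≤s h) = cong suc (length-take≤ i xs h)

  module _ {k : ℕ} where

    _≼_ : Word k → Word k → Set
    x ≼ y = x ≤ˡᵉˣ y ≡ true

    infix 4 _≼_

    _≟ʷ_ : (x y : Word k) → Dec (x ≡ y)
    _≟ʷ_ = ≡-dec FinP._≟_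

    <ᴸ-true : ∀ {a b : Fin k} → toℕ a < toℕ b → a <ᴸ b ≡ true
    <ᴸ-true {a} {b} a<b with suc (toℕ a) ≤? toℕ b
    ... | yes _ = refl
    ... | no a≮b = ⊥-elim (a≮b a<b)

    <ᴸ-false : ∀ {a b : Fin k} → ¬ (toℕ a < toℕ b) → a <ᴸ b ≡ false
    <ᴸ-false {a} {b} a≮b with suc (toℕ a) ≤? toℕ b
    ... | yes a<b = ⊥-elim (a≮b a<b)
    ... | no _ = refl

    <ᴸ-sound : ∀ {a b : Fin k} → a <ᴸ b ≡ true → toℕ a < toℕ b
    <ᴸ-sound {a} {b} _ with suc (toℕ a) ≤? toℕ b
    ... | yes a<b = a<b

    data LetterOrder (a b : Fin k) : Set where
      less : a <ᴸ b ≡ true → b <ᴸ a ≡ false → LetterOrder a b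
      same : a ≡ b → LetterOrder a b
      more : a <ᴸ b ≡ false → b <ᴸ a ≡ true → LetterOrder a b

    compareLetters : (a b : Fin k) → LetterOrder a b
    compareLetters a b with <-cmp (toℕ a) (toℕ b)
    ... | tri< a<b _ b≮a = less (<ᴸ-true a<b) (<ᴸ-false b≮a)
    ... | tri≈ _ a≡b _ = same (FinP.toℕ-injective a≡b)
    ... | tri> a≮b _ b<a = more (<ᴸ-false a≮b) (<ᴸ-true b<a)

    ≤ˡᵉˣ-same : (a : Fin k) (x y : Word k) → (a ∷ x) ≤ˡᵉˣ (a ∷ y) ≡ x ≤ˡᵉˣ y
    ≤ˡᵉˣ-same a x y rewrite <ᴸ-false {a} {a} (<-irrefl refl) with a FinP.≟ a
    ... | yes _ = refl
    ... | no a≢a = ⊥-elim (a≢a refl)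

    ≤ˡᵉˣ-less : {a b : Fin k} (x y : Word k) → a <ᴸ b ≡ true → (a ∷ x) ≤ˡᵉˣ (b ∷ y) ≡ true
    ≤ˡᵉˣ-less x y a<b rewrite a<b = refl

    ≤ˡᵉˣ-more : {a b : Fin k} (x y : Word k) → a <ᴸ b ≡ false → b <ᴸ a ≡ true → (a ∷ x) ≤ˡᵉˣ (b ∷ y) ≡ false
    ≤ˡᵉˣ-more {a} {b} x y a≮b b<a rewrite a≮b with a FinP.≟ b
    ... | no _ = refl
    ... | yes refl with trans (sym a≮b) b<a
    ... | ()

    ≼-refl : (x : Word k) → x ≼ x
    ≼-refl [] = refl
    ≼-refl (a ∷ x) = trans (≤ˡᵉˣ-same a x x) (≼-refl x)

    ≼-total : (x y : Word k) → x ≤ˡᵉˣ y ≡ false → y ≼ x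
    ≼-total [] y ()
    ≼-total (a ∷ x) [] _ = refl
    ≼-total (a ∷ x) (b ∷ y) x⋠y with compareLetters a b
    ... | less a<b _ rewrite ≤ˡᵉˣ-less x y a<b with x⋠y
    ... | ()
    ≼-total (a ∷ x) (b ∷ y) x⋠y | same refl =
      trans (≤ˡᵉˣ-same a y x) (≼-total x y (trans (sym (≤ˡᵉˣ-same a x y)) x⋠y))
    ≼-total (a ∷ x) (b ∷ y) x⋠y | more _ b<a = ≤ˡᵉˣ-less y x b<a

    ≼-trans : (x y z : Word k) → x ≼ y → y ≼ z → x ≼ z
    ≼-trans [] y z _ _ = refl
    ≼-trans (a ∷ x) (b ∷ y) (c ∷ z) x≼y y≼z with compareLetters a b | compareLetters b c
    ... | more a≮b b<a | _ rewrite ≤ˡᵉˣ-more x y a≮b b<a with x≼y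
    ... | ()
    ≼-trans (a ∷ x) (b ∷ y) (c ∷ z) x≼y y≼z | _ | more b≮c c<b rewrite ≤ˡᵉˣ-more y z b≮c c<b with y≼z
    ... | ()
    ≼-trans (a ∷ x) (b ∷ y) (c ∷ z) x≼y y≼z | same refl | same refl =
      trans (≤ˡᵉˣ-same a x z)
            (≼-trans x y z (trans (sym (≤ˡᵉˣ-same a x y)) x≼y) (trans (sym (≤ˡᵉˣ-same a y z)) y≼z))
    ≼-trans (a ∷ x) (b ∷ y) (c ∷ z) x≼y y≼z | same refl | less a<c _ = ≤ˡᵉˣ-less x z a<c
    ≼-trans (a ∷ x) (b ∷ y) (c ∷ z) x≼y y≼z | less a<b _ | same refl = ≤ˡᵉˣ-less x z a<b
    ≼-trans (a ∷ x) (b ∷ y) (c ∷ z) x≼y y≼z | less a<b _ | less b<c _ =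
      ≤ˡᵉˣ-less x z (<ᴸ-true (<-trans (<ᴸ-sound a<b) (<ᴸ-sound b<c)))

    ≼-antisym : (x y : Word k) → x ≼ y → y ≼ x → x ≡ y
    ≼-antisym [] [] _ _ = refl
    ≼-antisym (a ∷ x) (b ∷ y) x≼y y≼x with compareLetters a b
    ... | less a<b b≮a rewrite ≤ˡᵉˣ-more y x b≮a a<b with y≼x
    ... | ()
    ≼-antisym (a ∷ x) (b ∷ y) x≼y y≼x | more a≮b b<a rewrite ≤ˡᵉˣ-more x y a≮b b<a with x≼y
    ... | ()
    ≼-antisym (a ∷ x) (b ∷ y) x≼y y≼x | same refl =
      cong (a ∷_) (≼-antisym x y (trans (sym (≤ˡᵉˣ-same a x y)) x≼y) (trans (sym (≤ˡᵉˣ-same a y x)) y≼x))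

    ≤ˡᵉˣ-prefix : (u x y : Word k) → (u ++ x) ≤ˡᵉˣ (u ++ y) ≡ x ≤ˡᵉˣ y
    ≤ˡᵉˣ-prefix [] x y = refl
    ≤ˡᵉˣ-prefix (a ∷ u) x y = trans (≤ˡᵉˣ-same a (u ++ x) (u ++ y)) (≤ˡᵉˣ-prefix u x y)

    ≤ˡᵉˣ-distinctPrefix : (u v x y : Word k) → length u ≡ length v → u ≢ v →
                          (u ++ x) ≤ˡᵉˣ (v ++ y) ≡ u ≤ˡᵉˣ v
    ≤ˡᵉˣ-distinctPrefix [] [] x y _ u≢v = ⊥-elim (u≢v refl)
    ≤ˡᵉˣ-distinctPrefix (a ∷ u) (b ∷ v) x y |u|≡|v| u≢v with compareLetters a b
    ... | less a<b _ = trans (≤ˡᵉˣ-less (u ++ x) (v ++ y) a<b) (sym (≤ˡᵉˣ-less u v a<b))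
    ... | more a≮b b<a = trans (≤ˡᵉˣ-more (u ++ x) (v ++ y) a≮b b<a) (sym (≤ˡᵉˣ-more u v a≮b b<a))
    ... | same refl = begin
      (a ∷ u ++ x) ≤ˡᵉˣ (a ∷ v ++ y)  ≡⟨ ≤ˡᵉˣ-same a (u ++ x) (v ++ y) ⟩
      (u ++ x) ≤ˡᵉˣ (v ++ y)          ≡⟨ ≤ˡᵉˣ-distinctPrefix u v x y (suc-injective |u|≡|v|) (u≢v ∘ cong (a ∷_)) ⟩
      u ≤ˡᵉˣ v                        ≡⟨ sym (≤ˡᵉˣ-same a u v) ⟩
      (a ∷ u) ≤ˡᵉˣ (a ∷ v)            ∎
      where open ≡-Reasoning

    ≼-take : (e : ℕ) (x y : Word k) → x ≼ y → take e x ≼ take e y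
    ≼-take zero x y _ = refl
    ≼-take (suc e) [] y _ = refl
    ≼-take (suc e) (a ∷ x) (b ∷ y) x≼y with compareLetters a b
    ... | less a<b _ = ≤ˡᵉˣ-less (take e x) (take e y) a<b
    ... | more a≮b b<a rewrite ≤ˡᵉˣ-more x y a≮b b<a with x≼y
    ... | ()
    ≼-take (suc e) (a ∷ x) (b ∷ y) x≼y | same refl =
      trans (≤ˡᵉˣ-same a (take e x) (take e y)) (≼-take e x y (trans (sym (≤ˡᵉˣ-same a x y)) x≼y))

  module _ {k : ℕ} where

    length-rotate : ∀ i (x : Word k) → length (rotate i x) ≡ length x
    length-rotate zero x = trans (length-++ x) (+-identityʳ _)
    length-rotate (suc i) [] = refl
    length-rotate (suc i) (a ∷ x) = trans (length-++ (drop i x)) (trans (+-suc _ _)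
      (cong suc (trans (sym (length-++ (drop i x))) (length-rotate i x))))

    rotate-zero : (x : Word k) → rotate 0 x ≡ x
    rotate-zero x = ++-identityʳ x

    rotate-length : (x : Word k) → rotate (length x) x ≡ x
    rotate-length x rewrite drop-all (length x) x ≤-refl | take-all (length x) x ≤-refl = refl

    rotate-rotate : ∀ i j (x : Word k) → i + j ≤ length x → rotate i (rotate j x) ≡ rotate (i + j) x
    rotate-rotate i j x i+j≤n = begin
      drop i (drop j x ++ take j x) ++ take i (drop j x ++ take j x)
        ≡⟨ cong₂ _++_ (drop-++ˡ i (drop j x) _ i≤) (take-++ˡ i (drop j x) _ i≤) ⟩
      (drop i (drop j x) ++ take j x) ++ take i (drop j x)
        ≡⟨ ++-assoc (drop i (drop j x)) _ _ ⟩
      drop i (drop j x) ++ (take j x ++ take i (drop j x))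
        ≡⟨ cong₂ _++_ (drop-drop j i x) (sym (take-+ j i x)) ⟩
      drop (j + i) x ++ take (j + i) x
        ≡⟨ cong (λ z → rotate z x) (+-comm j i) ⟩
      rotate (i + j) x ∎
      where
      open ≡-Reasoning
      i≤ : i ≤ length (drop j x)
      i≤ rewrite length-drop j x = subst (_≤ length x ∸ j) (m+n∸n≡m i j) (∸-monoˡ-≤ j i+j≤n)

    rotate-inverse : ∀ j (x : Word k) → j ≤ length x → rotate (length x ∸ j) (rotate j x) ≡ x
    rotate-inverse j x j≤n = trans (rotate-rotate (length x ∸ j) j x (≤-reflexive (m∸n+n≡m j≤n)))
                                   (trans (cong (λ z → rotate z x) (m∸n+n≡m j≤n)) (rotate-length x))

    rotate-rotate-wrap : ∀ i j (x : Word k) → i ≤ length x → j ≤ length x → length x ≤ i + j →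
                         rotate i (rotate j x) ≡ rotate (i + j ∸ length x) x
    rotate-rotate-wrap i j x i≤n j≤n n≤i+j = begin
      rotate i (rotate j x)                          ≡⟨ cong (λ z → rotate z (rotate j x)) i≡r+[n∸j] ⟩
      rotate (r + (n ∸ j)) (rotate j x)              ≡⟨ sym (rotate-rotate r (n ∸ j) (rotate j x) r+[n∸j]≤) ⟩
      rotate r (rotate (n ∸ j) (rotate j x))         ≡⟨ cong (rotate r) (rotate-inverse j x j≤n) ⟩
      rotate r x                                     ∎
      where
      open ≡-Reasoning
      n = length x
      r = i + j ∸ n
      n∸j≤i : n ∸ j ≤ i
      n∸j≤i = ≤-trans (∸-monoˡ-≤ j n≤i+j) (≤-reflexive (m+n∸n≡m i j))
      i≡r+[n∸j] : i ≡ r + (n ∸ j)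
      i≡r+[n∸j] = sym (begin
        (i + j ∸ n) + (n ∸ j)                  ≡⟨ cong (λ z → (i + j ∸ z) + (n ∸ j)) (sym (m∸n+n≡m j≤n)) ⟩
        (i + j ∸ ((n ∸ j) + j)) + (n ∸ j)      ≡⟨ cong (_+ (n ∸ j)) (cong₂ _∸_ (+-comm i j) (+-comm (n ∸ j) j)) ⟩
        (j + i ∸ (j + (n ∸ j))) + (n ∸ j)      ≡⟨ cong (_+ (n ∸ j)) ([m+n]∸[m+o]≡n∸o j i (n ∸ j)) ⟩
        (i ∸ (n ∸ j)) + (n ∸ j)                ≡⟨ m∸n+n≡m n∸j≤i ⟩
        i                                      ∎)
      r+[n∸j]≤ : r + (n ∸ j) ≤ length (rotate j x)
      r+[n∸j]≤ = subst (_≤ length (rotate j x)) i≡r+[n∸j] (subst (i ≤_) (sym (length-rotate j x)) i≤n)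

    rotate-compose : ∀ i j (x : Word k) → i < length x → j ≤ length x →
                     ∃ λ l → l < length x × rotate i (rotate j x) ≡ rotate l x
    rotate-compose i j x i<n j≤n with i + j <? length x
    ... | yes i+j<n = i + j , i+j<n , rotate-rotate i j x (<⇒≤ i+j<n)
    ... | no i+j≮n = i + j ∸ length x , wrapped< , rotate-rotate-wrap i j x (<⇒≤ i<n) j≤n (≮⇒≥ i+j≮n)
      where
      wrapped< : i + j ∸ length x < length x
      wrapped< = ≤-<-trans (∸-monoˡ-≤ (length x) (+-monoʳ-≤ i j≤n))
                           (≤-trans (≤-reflexive (cong suc (m+n∸n≡m i (length x)))) i<n)

    rotate-mod : (x : Word k) (p : ℕ) → .{{_ : NonZero p}} → rotate p x ≡ x →
                 ∀ i → i ≤ length x → rotate i x ≡ rotate (i % p) x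
    rotate-mod x p fixed i = reduce i i ≤-refl
      where
      reduce : ∀ fuel i → i ≤ fuel → i ≤ length x → rotate i x ≡ rotate (i % p) x
      reduce fuel i i≤fuel i≤n with i <? p
      ... | yes i<p = cong (λ z → rotate z x) (sym (m<n⇒m%n≡m i<p))
      reduce zero i i≤0 i≤n | no i≮p = ⊥-elim (i≮p (≤-trans (s≤s i≤0) (>-nonZero⁻¹ p)))
      reduce (suc fuel) i i≤fuel i≤n | no i≮p = begin
        rotate i x                  ≡⟨ cong (λ z → rotate z x) (sym (m∸n+n≡m p≤i)) ⟩
        rotate (i ∸ p + p) x        ≡⟨ sym (rotate-rotate (i ∸ p) p x (subst (_≤ length x) (sym (m∸n+n≡m p≤i)) i≤n)) ⟩
        rotate (i ∸ p) (rotate p x) ≡⟨ cong (rotate (i ∸ p)) fixed ⟩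
        rotate (i ∸ p) x            ≡⟨ reduce fuel (i ∸ p) i∸p≤fuel (≤-trans (m∸n≤m i p) i≤n) ⟩
        rotate ((i ∸ p) % p) x      ≡⟨ cong (λ z → rotate z x) (m≤n⇒[n∸m]%m≡n%m p≤i) ⟩
        rotate (i % p) x            ∎
        where
        open ≡-Reasoning
        p≤i : p ≤ i
        p≤i = ≮⇒≥ i≮p
        i∸p≤fuel : i ∸ p ≤ fuel
        i∸p≤fuel = ≤-trans (∸-monoʳ-≤ i (>-nonZero⁻¹ p)) (∸-monoˡ-≤ 1 i≤fuel)

  module _ {k : ℕ} where

    -- power m u = u^m, spelled as in the definition of `isPrimitive`.
    power : ℕ → Word k → Word k
    power m u = concat (replicate m u)

    power-snoc : ∀ m (u : Word k) → power (suc m) u ≡ power m u ++ u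
    power-snoc zero u = ++-identityʳ u
    power-snoc (suc m) u = trans (cong (u ++_) (power-snoc m u)) (sym (++-assoc u (power m u) u))

    power-shift : ∀ m (s t : Word k) → s ++ power m (t ++ s) ≡ power m (s ++ t) ++ s
    power-shift zero s t = ++-identityʳ s
    power-shift (suc m) s t = begin
      s ++ ((t ++ s) ++ power m (t ++ s))      ≡⟨ cong (s ++_) (++-assoc t s _) ⟩
      s ++ (t ++ (s ++ power m (t ++ s)))      ≡⟨ sym (++-assoc s t _) ⟩
      (s ++ t) ++ (s ++ power m (t ++ s))      ≡⟨ cong ((s ++ t) ++_) (power-shift m s t) ⟩
      (s ++ t) ++ (power m (s ++ t) ++ s)      ≡⟨ sym (++-assoc (s ++ t) _ s) ⟩
      power (suc m) (s ++ t) ++ s              ∎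
      where open ≡-Reasoning

    length-power : ∀ m (u : Word k) → length (power m u) ≡ m * length u
    length-power zero u = refl
    length-power (suc m) u = trans (length-++ u) (cong (length u +_) (length-power m u))

    take-power : ∀ m (u : Word k) → take (length u) (power (suc m) u) ≡ u
    take-power m u = take-length-++ u (power m u)

    rotate-power : ∀ m j (u : Word k) → j ≤ length u → rotate j (power m u) ≡ power m (rotate j u)
    rotate-power zero zero u _ = refl
    rotate-power zero (suc j) u _ = refl
    rotate-power (suc m) j u j≤ = begin
      drop j (u ++ P) ++ take j (u ++ P)   ≡⟨ cong₂ _++_ (drop-++ˡ j u P j≤) (take-++ˡ j u P j≤) ⟩
      (s ++ P) ++ t                        ≡⟨ cong (λ z → (s ++ power m z) ++ t) (sym (take++drop≡id j u)) ⟩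
      (s ++ power m (t ++ s)) ++ t         ≡⟨ cong (_++ t) (power-shift m s t) ⟩
      (power m (s ++ t) ++ s) ++ t         ≡⟨ ++-assoc (power m (s ++ t)) s t ⟩
      power m (s ++ t) ++ (s ++ t)         ≡⟨ sym (power-snoc m (s ++ t)) ⟩
      power (suc m) (rotate j u)           ∎
      where
      open ≡-Reasoning
      P = power m u
      s = drop j u
      t = take j u

    rotate-power-root : ∀ m (u : Word k) → rotate (length u) (power m u) ≡ power m u
    rotate-power-root m u = trans (rotate-power m (length u) u ≤-refl) (cong (power m) (rotate-length u))

    power-injective : ∀ m (u v : Word k) → length u ≡ length v → power (suc m) u ≡ power (suc m) v → u ≡ v
    power-injective m u v |u|≡|v| uᵐ≡vᵐ = begin
      u                                  ≡⟨ sym (take-power m u) ⟩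
      take (length u) (power (suc m) u)  ≡⟨ cong₂ take |u|≡|v| uᵐ≡vᵐ ⟩
      take (length v) (power (suc m) v)  ≡⟨ take-power m v ⟩
      v                                  ∎
      where open ≡-Reasoning

    power-monotone : ∀ m (u v : Word k) → length u ≡ length v → u ≼ v → power m u ≼ power m v
    power-monotone zero u v _ _ = refl
    power-monotone (suc m) u v |u|≡|v| u≼v with u ≟ʷ v
    ... | yes refl = trans (≤ˡᵉˣ-prefix u (power m u) (power m u)) (≼-refl (power m u))
    ... | no u≢v = trans (≤ˡᵉˣ-distinctPrefix u v (power m u) (power m v) |u|≡|v| u≢v) u≼v

  module _ {k : ℕ} where

    foldMin-∈ : (s : Word k) (L : List (Word k)) → foldr lexMin s L ∈ s ∷ L
    foldMin-∈ s [] = here refl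
    foldMin-∈ s (z ∷ L) with z ≤ˡᵉˣ foldr lexMin s L
    ... | true = there (here refl)
    ... | false with foldMin-∈ s L
    ... | here eq = here eq
    ... | there z∈ = there (there z∈)

    foldMin-≼ : (s : Word k) (L : List (Word k)) → ∀ {y} → y ∈ s ∷ L → foldr lexMin s L ≼ y
    foldMin-≼ s [] (here refl) = ≼-refl s
    foldMin-≼ s (z ∷ L) {y} y∈ with z ≤ˡᵉˣ foldr lexMin s L in z≼min
    ... | true with y∈
    ... | here refl = ≼-trans z _ s z≼min (foldMin-≼ s L (here refl))
    ... | there (here refl) = ≼-refl z
    ... | there (there y∈L) = ≼-trans z _ y z≼min (foldMin-≼ s L (there y∈L))
    foldMin-≼ s (z ∷ L) {y} y∈ | false with y∈
    ... | here refl = foldMin-≼ s L (here refl)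
    ... | there (here refl) = ≼-total z _ z≼min
    ... | there (there y∈L) = foldMin-≼ s L (there y∈L)

    minRot-isRotation : (x : Word k) → 1 ≤ length x → ∃ λ j → j < length x × minRot x ≡ rotate j x
    minRot-isRotation x 1≤n with foldMin-∈ x (rotations x)
    ... | here eq = 0 , 1≤n , trans eq (sym (rotate-zero x))
    ... | there m∈ with ∈-map⁻ (λ i → rotate i x) m∈
    ... | j , j∈ , eq = j , ∈-upTo⁻ j∈ , eq

    minRot-≼ : (x : Word k) → ∀ i → i < length x → minRot x ≼ rotate i x
    minRot-≼ x i i<n = foldMin-≼ x (rotations x) (there (∈-map⁺ (λ i → rotate i x) (∈-upTo⁺ i<n)))

    length-minRot : (x : Word k) → length (minRot x) ≡ length x
    length-minRot [] = refl
    length-minRot x@(_ ∷ _) with minRot-isRotation x (s≤s z≤n)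
    ... | j , _ , eq = trans (cong length eq) (length-rotate j x)

    minRot-rotate : (x : Word k) → ∀ i → i < length x → minRot (rotate i x) ≡ minRot x
    minRot-rotate x i i<n = ≼-antisym _ _ ⟨z⟩≼⟨x⟩ ⟨x⟩≼⟨z⟩
      where
      n = length x
      z = rotate i x
      |z|≡n : length z ≡ n
      |z|≡n = length-rotate i x
      1≤n : 1 ≤ n
      1≤n = ≤-trans (s≤s z≤n) i<n
      ⟨z⟩≼⟨x⟩ : minRot z ≼ minRot x
      ⟨z⟩≼⟨x⟩ with minRot-isRotation x 1≤n
      ... | b , b<n , eq with rotate-compose b (n ∸ i) z (subst (b <_) (sym |z|≡n) b<n)
                                             (subst (n ∸ i ≤_) (sym |z|≡n) (m∸n≤m n i))
      ... | l , l<n , eq′ = subst (minRot z ≼_)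
            (sym (trans eq (trans (cong (rotate b) (sym (rotate-inverse i x (<⇒≤ i<n)))) eq′)))
            (minRot-≼ z l l<n)
      ⟨x⟩≼⟨z⟩ : minRot x ≼ minRot z
      ⟨x⟩≼⟨z⟩ with minRot-isRotation z (subst (1 ≤_) (sym |z|≡n) 1≤n)
      ... | a , a<n , eq with rotate-compose a i x (subst (a <_) |z|≡n a<n) (<⇒≤ i<n)
      ... | l , l<n , eq′ = subst (minRot x ≼_) (sym (trans eq eq′)) (minRot-≼ x l l<n)

    minRot-idempotent : (x : Word k) → minRot (minRot x) ≡ minRot x
    minRot-idempotent [] = refl
    minRot-idempotent x@(_ ∷ _) with minRot-isRotation x (s≤s z≤n)
    ... | j , j<n , eq = trans (cong minRot eq) (minRot-rotate x j j<n)

    selfMinimal⇐ : (x : Word k) → 1 ≤ length x → (∀ i → i < length x → x ≼ rotate i x) → SelfMinimal x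
    selfMinimal⇐ x 1≤n x≼rotations with minRot-isRotation x 1≤n
    ... | j , j<n , eq = ≼-antisym _ _ (subst (minRot x ≼_) (rotate-zero x) (minRot-≼ x 0 1≤n))
                                       (subst (x ≼_) (sym eq) (x≼rotations j j<n))

    selfMinimal⇒ : (x : Word k) → SelfMinimal x → ∀ i → i < length x → x ≼ rotate i x
    selfMinimal⇒ x sm i i<n = subst (_≼ rotate i x) sm (minRot-≼ x i i<n)

    isSelfMinimal⇒ : (x : Word k) → isSelfMinimal x ≡ true → SelfMinimal x
    isSelfMinimal⇒ x t with minRot x ≟ʷ x
    ... | yes sm = sm

    isSelfMinimal⇐ : (x : Word k) → SelfMinimal x → isSelfMinimal x ≡ true
    isSelfMinimal⇐ x sm with minRot x ≟ʷ x
    ... | yes _ = refl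
    ... | no ¬sm = ⊥-elim (¬sm sm)

  module _ {k : ℕ} where

    -- firstFix x f i is the least j ∈ [i, i + f) with rotate j x ≡ x, or i + f if there is none.
    firstFix : Word k → ℕ → ℕ → ℕ
    firstFix x zero i = i
    firstFix x (suc f) i with rotate i x ≟ʷ x
    ... | yes _ = i
    ... | no _ = firstFix x f (suc i)

    firstFix-bounds : ∀ x f i → i ≤ firstFix x f i × firstFix x f i ≤ i + f
    firstFix-bounds x zero i = ≤-refl , ≤-reflexive (sym (+-identityʳ i))
    firstFix-bounds x (suc f) i with rotate i x ≟ʷ x
    ... | yes _ = ≤-refl , m≤m+n i (suc f)
    ... | no _ with firstFix-bounds x f (suc i)
    ... | lower , upper = <⇒≤ lower , ≤-trans upper (≤-reflexive (sym (+-suc i f)))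

    firstFix-fixes : ∀ x f i → rotate (firstFix x f i) x ≡ x ⊎ firstFix x f i ≡ i + f
    firstFix-fixes x zero i = inj₂ (sym (+-identityʳ i))
    firstFix-fixes x (suc f) i with rotate i x ≟ʷ x
    ... | yes fixed = inj₁ fixed
    ... | no _ with firstFix-fixes x f (suc i)
    ... | inj₁ fixed = inj₁ fixed
    ... | inj₂ eq = inj₂ (trans eq (sym (+-suc i f)))

    firstFix-least : ∀ x f i j → i ≤ j → j < firstFix x f i → rotate j x ≢ x
    firstFix-least x zero i j i≤j j< = ⊥-elim (<⇒≱ j< i≤j)
    firstFix-least x (suc f) i j i≤j j< with rotate i x ≟ʷ x
    ... | yes _ = ⊥-elim (<⇒≱ j< i≤j)
    ... | no ¬fixed with m≤n⇒m<n∨m≡n i≤j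
    ... | inj₂ refl = ¬fixed
    ... | inj₁ i<j = firstFix-least x f (suc i) j i<j j<

    period : Word k → ℕ
    period x = firstFix x (length x ∸ 1) 1

    module _ (x : Word k) (1≤n : 1 ≤ length x) where
      private
        n = length x
        1+[n∸1]≡n : 1 + (n ∸ 1) ≡ n
        1+[n∸1]≡n = m+[n∸m]≡n 1≤n

      period-pos : 1 ≤ period x
      period-pos = proj₁ (firstFix-bounds x (n ∸ 1) 1)

      period≤length : period x ≤ n
      period≤length = ≤-trans (proj₂ (firstFix-bounds x (n ∸ 1) 1)) (≤-reflexive 1+[n∸1]≡n)

      rotate-period : rotate (period x) x ≡ x
      rotate-period with firstFix-fixes x (n ∸ 1) 1
      ... | inj₁ fixed = fixed
      ... | inj₂ eq = trans (cong (λ z → rotate z x) (trans eq 1+[n∸1]≡n)) (rotate-length x)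

      period-least : ∀ j → 1 ≤ j → rotate j x ≡ x → period x ≤ j
      period-least j 1≤j fixed with period x ≤? j
      ... | yes p≤j = p≤j
      ... | no p≰j = ⊥-elim (firstFix-least x (n ∸ 1) 1 j 1≤j (≰⇒> p≰j) fixed)

      -- The period divides the length: n mod p is again a fixing rotation amount below p.
      period-∣ : period x ∣ n
      period-∣ = m%n≡0⇒n∣m n p n%p≡0
        where
        p = period x
        instance _ = >-nonZero period-pos
        fixes-n%p : rotate (n % p) x ≡ x
        fixes-n%p = trans (sym (rotate-mod x p rotate-period n ≤-refl)) (rotate-length x)
        n%p≡0 : n % p ≡ 0
        n%p≡0 with n % p in eq
        ... | zero = refl
        ... | suc r = ⊥-elim (<⇒≱ (subst (_< p) eq (m%n<n n p))
                        (period-least (suc r) (s≤s z≤n) (subst (λ z → rotate z x ≡ x) eq fixes-n%p)))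

    commuting⇒power : ∀ m (u z : Word k) → length z ≡ m * length u → z ++ u ≡ u ++ z → z ≡ power m u
    commuting⇒power zero u [] _ _ = refl
    commuting⇒power (suc m) u z |z| zu≡uz = begin
      z                 ≡⟨ sym (take++drop≡id (length u) z) ⟩
      take e z ++ z′    ≡⟨ cong (_++ z′) take-e-z≡u ⟩
      u ++ z′           ≡⟨ cong (u ++_) (commuting⇒power m u z′ |z′| z′u≡uz′) ⟩
      u ++ power m u    ∎
      where
      open ≡-Reasoning
      e = length u
      z′ = drop e z
      e≤|z| : e ≤ length z
      e≤|z| = subst (e ≤_) (sym |z|) (m≤m+n e (m * e))
      |z′| : length z′ ≡ m * e
      |z′| = trans (length-drop e z) (trans (cong (_∸ e) |z|) (m+n∸m≡n e (m * e)))
      take-e-z≡u : take e z ≡ u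
      take-e-z≡u = begin
        take e z         ≡⟨ sym (take-++ˡ e z u e≤|z|) ⟩
        take e (z ++ u)  ≡⟨ cong (take e) zu≡uz ⟩
        take e (u ++ z)  ≡⟨ take-length-++ u z ⟩
        u                ∎
      z≡uz′ : z ≡ u ++ z′
      z≡uz′ = trans (sym (take++drop≡id e z)) (cong (_++ z′) take-e-z≡u)
      z′u≡uz′ : z′ ++ u ≡ u ++ z′
      z′u≡uz′ = ++-cancelˡ u (z′ ++ u) (u ++ z′) (begin
        u ++ (z′ ++ u)   ≡⟨ sym (++-assoc u z′ u) ⟩
        (u ++ z′) ++ u   ≡⟨ cong (_++ u) (sym z≡uz′) ⟩
        z ++ u           ≡⟨ zu≡uz ⟩
        u ++ z           ≡⟨ cong (u ++_) z≡uz′ ⟩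
        u ++ (u ++ z′)   ∎)

    power-of-fixed : ∀ m p (y : Word k) → length y ≡ m * p → rotate p y ≡ y → y ≡ power m (take p y)
    power-of-fixed zero p [] _ _ = refl
    power-of-fixed (suc m) p y |y| fixed = begin
      y                  ≡⟨ sym (take++drop≡id p y) ⟩
      u ++ z             ≡⟨ cong (u ++_) (commuting⇒power m u z |z| zu≡uz) ⟩
      u ++ power m u     ∎
      where
      open ≡-Reasoning
      u = take p y
      z = drop p y
      |u| : length u ≡ p
      |u| = length-take≤ p y (subst (p ≤_) (sym |y|) (m≤m+n p (m * p)))
      |z| : length z ≡ m * length u
      |z| = trans (length-drop p y) (trans (cong (_∸ p) |y|) (trans (m+n∸m≡n p (m * p)) (cong (m *_) (sym |u|))))
      zu≡uz : z ++ u ≡ u ++ z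
      zu≡uz = trans fixed (sym (take++drop≡id p y))

    period-root : (x : Word k) (1≤n : 1 ≤ length x) → period (take (period x) x) ≡ period x
    period-root x 1≤n = ≤-antisym (subst (period ℓ ≤_) |ℓ| (period≤length ℓ 1≤|ℓ|)) p≤period-ℓ
      where
      p = period x
      instance _ = >-nonZero (period-pos x 1≤n)
      ℓ = take p x
      |ℓ| : length ℓ ≡ p
      |ℓ| = length-take≤ p x (period≤length x 1≤n)
      1≤|ℓ| : 1 ≤ length ℓ
      1≤|ℓ| = subst (1 ≤_) (sym |ℓ|) (period-pos x 1≤n)
      m = length x / p
      x≡ℓᵐ : x ≡ power m ℓ
      x≡ℓᵐ = power-of-fixed m p x (sym (m/n*n≡m (period-∣ x 1≤n))) (rotate-period x 1≤n)
      p≤period-ℓ : p ≤ period ℓ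
      p≤period-ℓ = period-least x 1≤n (period ℓ) (period-pos ℓ 1≤|ℓ|) (begin
        rotate (period ℓ) x             ≡⟨ cong (rotate (period ℓ)) x≡ℓᵐ ⟩
        rotate (period ℓ) (power m ℓ)   ≡⟨ rotate-power m (period ℓ) ℓ (period≤length ℓ 1≤|ℓ|) ⟩
        power m (rotate (period ℓ) ℓ)   ≡⟨ cong (power m) (rotate-period ℓ 1≤|ℓ|) ⟩
        power m ℓ                       ≡⟨ sym x≡ℓᵐ ⟩
        x                               ∎)
        where open ≡-Reasoning

    period-power : (ℓ : Word k) (m : ℕ) → 1 ≤ length ℓ → period ℓ ≡ length ℓ →
                   period (power (suc m) ℓ) ≡ length ℓ
    period-power ℓ m 1≤e full = ≤-antisym q≤e e≤q
      where
      y = power (suc m) ℓ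
      e = length ℓ
      1≤|y| : 1 ≤ length y
      1≤|y| = subst (1 ≤_) (sym (length-power (suc m) ℓ)) (≤-trans 1≤e (m≤m+n e (m * e)))
      q = period y
      q≤e : q ≤ e
      q≤e = period-least y 1≤|y| e 1≤e (rotate-power-root (suc m) ℓ)
      e≤q : e ≤ q
      e≤q = subst (_≤ q) full (period-least ℓ 1≤e q (period-pos y 1≤|y|)
              (power-injective m (rotate q ℓ) ℓ (length-rotate q ℓ)
                (trans (sym (rotate-power (suc m) q ℓ q≤e)) (rotate-period y 1≤|y|))))

  module _ {k : ℕ} where

    rotate-root : ∀ m d (x : Word k) → d ≤ length x → x ≡ power m (take d x) → rotate d x ≡ x
    rotate-root m d x d≤n x≡uᵐ = begin
      rotate d x                     ≡⟨ cong (rotate d) x≡uᵐ ⟩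
      rotate d (power m u)           ≡⟨ cong (λ z → rotate z (power m u)) (sym (length-take≤ d x d≤n)) ⟩
      rotate (length u) (power m u)  ≡⟨ rotate-power-root m u ⟩
      power m u                      ≡⟨ sym x≡uᵐ ⟩
      x                              ∎
      where
      open ≡-Reasoning
      u = take d x

    primitive⇐ : (x : Word k) → 1 ≤ length x → period x ≡ length x → isPrimitive x ≡ true
    primitive⇐ x 1≤n full = not-true (λ t → noProperRoot (satisfied (any⁻ _ (upTo n) t)))
      where
      n = length x
      not-true : ∀ {b} → (T b → ⊥) → not b ≡ true
      not-true {false} _ = refl
      not-true {true} ¬b = ⊥-elim (¬b _)
      -- the predicate is the (local) proper-root test inside `isPrimitive`
      noProperRoot : ∃ (λ d → _) → ⊥
      noProperRoot (zero , ())
      noProperRoot (suc d , t) with Equivalence.to (T-∧ {⌊ suc d ∣? n ⌋}) t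
      ... | d∣n , t′ with Equivalence.to (T-∧ {not ⌊ suc d ≟ n ⌋}) t′
      ... | d≢n , x≡uᵐ = <⇒≱ d<n (subst (_≤ suc d) full
            (period-least x 1≤n (suc d) (s≤s z≤n) (rotate-root (n / suc d) (suc d) x (<⇒≤ d<n) (toWitness x≡uᵐ))))
        where
        d<n : suc d < n
        d<n = ≤∧≢⇒< (∣⇒≤ {{>-nonZero 1≤n}} (toWitness d∣n)) (toWitnessFalse d≢n)

    properRoot⇒¬primitive : (x : Word k) → ∀ d → 1 ≤ d → d < length x → d ∣ length x →
      .{{_ : NonZero d}} → x ≡ power (length x / d) (take d x) → isPrimitive x ≢ true
    properRoot⇒¬primitive x (suc d) _ d<n d∣n x≡uᵐ =
      not-false (any⁺ _ (lose (∈-upTo⁺ d<n)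
        (Equivalence.from (T-∧ {⌊ suc d ∣? n ⌋}) (fromWitness d∣n ,
          Equivalence.from (T-∧ {not ⌊ suc d ≟ n ⌋}) (fromWitnessFalse (<⇒≢ d<n) , fromWitness x≡uᵐ)))))
      where
      n = length x
      not-false : ∀ {b} → T b → not b ≢ true
      not-false {true} _ ()

    primitive⇒ : (x : Word k) → 1 ≤ length x → isPrimitive x ≡ true → period x ≡ length x
    primitive⇒ x 1≤n prim with period x ≟ length x
    ... | yes full = full
    ... | no ¬full = ⊥-elim (properRoot⇒¬primitive x p (period-pos x 1≤n) p<n (period-∣ x 1≤n) x≡rootᵐ prim)
      where
      n = length x
      p = period x
      instance _ = >-nonZero (period-pos x 1≤n)
      p<n : p < n
      p<n = ≤∧≢⇒< (period≤length x 1≤n) ¬full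
      x≡rootᵐ : x ≡ power (n / p) (take p x)
      x≡rootᵐ = power-of-fixed (n / p) p x (sym (m/n*n≡m (period-∣ x 1≤n))) (rotate-period x 1≤n)

  module _ {k : ℕ} where

    selfMinimal-power⇒ : (ℓ : Word k) (m : ℕ) → 1 ≤ length ℓ → SelfMinimal (power (suc m) ℓ) → SelfMinimal ℓ
    selfMinimal-power⇒ ℓ m 1≤e sm = selfMinimal⇐ ℓ 1≤e ℓ≼rotations
      where
      ℓ≼rotations : ∀ i → i < length ℓ → ℓ ≼ rotate i ℓ
      ℓ≼rotations i i<e = subst₂ _≼_ (take-power m ℓ) take-rotated (≼-take (length ℓ) _ _ ℓᵐ≼rotated)
        where
        i<|ℓᵐ| : i < length (power (suc m) ℓ)
        i<|ℓᵐ| = subst (i <_) (sym (length-power (suc m) ℓ)) (≤-trans i<e (m≤m+n _ _))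
        ℓᵐ≼rotated : power (suc m) ℓ ≼ power (suc m) (rotate i ℓ)
        ℓᵐ≼rotated = subst (power (suc m) ℓ ≼_) (rotate-power (suc m) i ℓ (<⇒≤ i<e))
                           (selfMinimal⇒ (power (suc m) ℓ) sm i i<|ℓᵐ|)
        take-rotated : take (length ℓ) (power (suc m) (rotate i ℓ)) ≡ rotate i ℓ
        take-rotated = trans (cong (λ z → take z (power (suc m) (rotate i ℓ))) (sym (length-rotate i ℓ)))
                             (take-power m (rotate i ℓ))

    selfMinimal-power⇐ : (ℓ : Word k) (m : ℕ) → 1 ≤ length ℓ → SelfMinimal ℓ → SelfMinimal (power (suc m) ℓ)
    selfMinimal-power⇐ ℓ m 1≤e sm = selfMinimal⇐ y 1≤|y| y≼rotations
      where
      y = power (suc m) ℓ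
      e = length ℓ
      instance _ = >-nonZero 1≤e
      1≤|y| : 1 ≤ length y
      1≤|y| = subst (1 ≤_) (sym (length-power (suc m) ℓ)) (≤-trans 1≤e (m≤m+n e (m * e)))
      -- rotating y by i is rotating its root by i mod |ℓ|
      y≼rotations : ∀ i → i < length y → y ≼ rotate i y
      y≼rotations i i<|y| = subst (y ≼_) (sym rotated)
        (power-monotone (suc m) ℓ (rotate (i % e) ℓ) (sym (length-rotate (i % e) ℓ)) (selfMinimal⇒ ℓ sm (i % e) (m%n<n i e)))
        where
        rotated : rotate i y ≡ power (suc m) (rotate (i % e) ℓ)
        rotated = trans (rotate-mod y e (rotate-power-root (suc m) ℓ) i (<⇒≤ i<|y|))
                        (rotate-power (suc m) (i % e) ℓ (<⇒≤ (m%n<n i e)))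

    lyndon⇐ : (ℓ : Word k) → 1 ≤ length ℓ → period ℓ ≡ length ℓ → SelfMinimal ℓ → isLyndon ℓ ≡ true
    lyndon⇐ ℓ 1≤e full sm rewrite primitive⇐ ℓ 1≤e full = isSelfMinimal⇐ ℓ sm

    lyndon⇒ : (ℓ : Word k) → 1 ≤ length ℓ → isLyndon ℓ ≡ true → period ℓ ≡ length ℓ × SelfMinimal ℓ
    lyndon⇒ ℓ 1≤e lyn with isPrimitive ℓ in prim
    ... | true = primitive⇒ ℓ 1≤e prim , isSelfMinimal⇒ ℓ lyn

module Necklaces where

  open FiniteSums
  open Möbius
  open Words
  open import Data.Bool using (Bool; true; false) renaming (_≟_ to _≟ᵇ_)
  open import Data.Bool.Properties using (⇔→≡)
  open import Data.Empty using (⊥-elim)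
  open import Data.Fin using (Fin)
  open import Data.Integer using (ℤ; +_; 0ℤ; 1ℤ) renaming (_*_ to _*ℤ_)
  import Data.Integer.Properties as ℤP
  open import Data.List using (List; []; _∷_; _++_; map; filter; length; upTo; take; drop; allFin)
  open import Data.List.Membership.Propositional using (_∈_)
  open import Data.List.Membership.Propositional.Properties
    using (∈-map⁻; ∈-map⁺; ∈-filter⁻; ∈-filter⁺; ∈-upTo⁺; ∈-upTo⁻; ∈-concat⁻′; ∈-concat⁺′; ∈-allFin)
  open import Data.List.Properties using (length-upTo; length-map; take-take; drop-drop; length-drop)
  import Data.List.Relation.Unary.All as All
  import Data.List.Relation.Unary.All.Properties as All
  import Data.List.Relation.Unary.AllPairs as AllPairs
  import Data.List.Relation.Unary.AllPairs.Properties as AllPairs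
  open import Data.List.Relation.Unary.Any using (here)
  open import Data.List.Relation.Unary.Unique.Propositional using (Unique)
  import Data.List.Relation.Unary.Unique.Propositional.Properties as Unique
  open import Data.Nat
  open import Data.Nat.Divisibility using (_∣_; ∣⇒≤)
  open import Data.Nat.DivMod using (_%_; m%n<n)
  open import Data.Nat.Properties
  open import Data.Product using (_×_; _,_; proj₁; proj₂)
  open import Function using (mk⇔)
  open import Relation.Binary.Definitions using (tri<; tri≈; tri>)
  open import Relation.Binary.PropositionalEquality
  open import Relation.Nullary using (Dec; yes; no; ¬_; does)
  open import Relation.Nullary.Decidable using (_×-dec_)

  module _ {k : ℕ} where

    ∈-allWords⁻ : ∀ {n} {x : Word k} → x ∈ allWords k n → length x ≡ n
    ∈-allWords⁻ {zero} (here refl) = refl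
    ∈-allWords⁻ {suc n} {x} x∈ with ∈-concat⁻′ (map (λ a → map (a ∷_) (allWords k n)) (allFin k)) x∈
    ... | xs , x∈xs , xs∈ with ∈-map⁻ (λ a → map (a ∷_) (allWords k n)) xs∈
    ... | a , _ , refl with ∈-map⁻ (a ∷_) x∈xs
    ... | y , y∈ , refl = cong suc (∈-allWords⁻ y∈)

    ∈-allWords⁺ : ∀ {n} {x : Word k} → length x ≡ n → x ∈ allWords k n
    ∈-allWords⁺ {zero} {[]} refl = here refl
    ∈-allWords⁺ {suc n} {a ∷ x} |x|≡n =
      ∈-concat⁺′ (∈-map⁺ (a ∷_) (∈-allWords⁺ (suc-injective |x|≡n)))
                 (∈-map⁺ (λ a → map (a ∷_) (allWords k n)) (∈-allFin a))

    allWords-unique : ∀ n → Unique (allWords k n)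
    allWords-unique zero = All.[] AllPairs.∷ AllPairs.[]
    allWords-unique (suc n) =
      Unique.concat⁺ (All.map⁺ (All.tabulate (λ _ → Unique.map⁺ ∷-injectiveʳ (allWords-unique n))))
                     (AllPairs.map⁺ (AllPairs.map disjoint (Unique.allFin⁺ k)))
      where
      ∷-injectiveʳ : ∀ {a b : Fin k} {x y : Word k} → a ∷ x ≡ b ∷ y → x ≡ y
      ∷-injectiveʳ refl = refl
      disjoint : ∀ {a b : Fin k} → a ≢ b → ∀ {v} → ¬ (v ∈ map (a ∷_) (allWords k n) × v ∈ map (b ∷_) (allWords k n))
      disjoint a≢b (v∈a , v∈b) with ∈-map⁻ (_ ∷_) v∈a | ∈-map⁻ (_ ∷_) v∈b
      ... | _ , _ , refl | _ , _ , refl = a≢b refl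

  module _ {k : ℕ} where

    open SetSum (_≟ʷ_ {k}) using () renaming (∑-reindex to ∑-reindexʷ; ∑-select to ∑-selectʷ)

    -- The rotation class of y, each rotation listed once.
    orbit : Word k → List (Word k)
    orbit y = map (λ i → rotate i y) (upTo (period y))

    rotations-distinct : (y : Word k) → 1 ≤ length y → ∀ i j → i < j → j < period y → rotate i y ≢ rotate j y
    rotations-distinct y 1≤n i j i<j j<p ij≡ =
      <⇒≱ (≤-<-trans (m∸n≤m j i) j<p) (period-least y 1≤n (j ∸ i) (m<n⇒0<n∸m i<j) fixes-j∸i)
      where
      n = length y
      i≤n : i ≤ n
      i≤n = ≤-trans (<⇒≤ (<-≤-trans i<j (<⇒≤ j<p))) (period≤length y 1≤n)
      j≤n : j ≤ n
      j≤n = ≤-trans (<⇒≤ j<p) (period≤length y 1≤n)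
      wrap : (n ∸ i) + j ∸ n ≡ j ∸ i
      wrap = begin
        (n ∸ i) + j ∸ n              ≡⟨ cong (λ z → (n ∸ i) + z ∸ n) (sym (m+[n∸m]≡n (<⇒≤ i<j))) ⟩
        (n ∸ i) + (i + (j ∸ i)) ∸ n  ≡⟨ cong (_∸ n) (sym (+-assoc (n ∸ i) i (j ∸ i))) ⟩
        (n ∸ i) + i + (j ∸ i) ∸ n    ≡⟨ cong (λ z → z + (j ∸ i) ∸ n) (m∸n+n≡m i≤n) ⟩
        n + (j ∸ i) ∸ n              ≡⟨ m+n∸m≡n n (j ∸ i) ⟩
        j ∸ i                        ∎
        where open ≡-Reasoning
      n≤ : n ≤ (n ∸ i) + j
      n≤ = ≤-trans (≤-reflexive (sym (m∸n+n≡m i≤n))) (+-monoʳ-≤ (n ∸ i) (<⇒≤ i<j))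
      fixes-j∸i : rotate (j ∸ i) y ≡ y
      fixes-j∸i = begin
        rotate (j ∸ i) y                 ≡⟨ cong (λ z → rotate z y) (sym wrap) ⟩
        rotate ((n ∸ i) + j ∸ n) y       ≡⟨ sym (rotate-rotate-wrap (n ∸ i) j y (m∸n≤m n i) j≤n n≤) ⟩
        rotate (n ∸ i) (rotate j y)      ≡⟨ cong (rotate (n ∸ i)) (sym ij≡) ⟩
        rotate (n ∸ i) (rotate i y)      ≡⟨ rotate-inverse i y i≤n ⟩
        y                                ∎
        where open ≡-Reasoning

    orbit-unique : (y : Word k) → 1 ≤ length y → Unique (orbit y)
    orbit-unique y 1≤n = map-unique (λ i → rotate i y) (upTo (period y)) (Unique.upTo⁺ (period y)) injective
      where
      injective : ∀ {i j} → i ∈ upTo (period y) → j ∈ upTo (period y) → rotate i y ≡ rotate j y → i ≡ j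
      injective {i} {j} i∈ j∈ ij≡ with <-cmp i j
      ... | tri< i<j _ _ = ⊥-elim (rotations-distinct y 1≤n i j i<j (∈-upTo⁻ j∈) ij≡)
      ... | tri≈ _ i≡j _ = i≡j
      ... | tri> _ _ j<i = ⊥-elim (rotations-distinct y 1≤n j i j<i (∈-upTo⁻ i∈) (sym ij≡))

    module Fibre (d : ℕ) (y : Word k) (|y|≡d : length y ≡ d) (1≤d : 1 ≤ d) (sm : SelfMinimal y) where

      private
        1≤|y| : 1 ≤ length y
        1≤|y| = subst (1 ≤_) (sym |y|≡d) 1≤d
        instance _ = >-nonZero (period-pos y 1≤|y|)

      preimages : List (Word k)
      preimages = filter (λ x → y ≟ʷ minRot x) (allWords k d)

      -- If ⟨x⟩ = y = rotate j x, then x is y rotated back by (|x| − j) mod period(y).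
      minRot≡⇒∈orbit : (x : Word k) → length x ≡ length y → minRot x ≡ y → x ∈ orbit y
      minRot≡⇒∈orbit x |x|≡|y| ⟨x⟩≡y with minRot-isRotation x (subst (1 ≤_) (sym |x|≡|y|) 1≤|y|)
      ... | j , j<n , ⟨x⟩≡ = subst (_∈ orbit y) (sym x≡) (∈-map⁺ (λ i → rotate i y) (∈-upTo⁺ (m%n<n r (period y))))
        where
        r = length x ∸ j
        x≡ : x ≡ rotate (r % period y) y
        x≡ = begin
          x                        ≡⟨ sym (rotate-inverse j x (<⇒≤ j<n)) ⟩
          rotate r (rotate j x)    ≡⟨ cong (rotate r) (trans (sym ⟨x⟩≡) ⟨x⟩≡y) ⟩
          rotate r y               ≡⟨ rotate-mod y (period y) (rotate-period y 1≤|y|) r r≤n ⟩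
          rotate (r % period y) y  ∎
          where
          open ≡-Reasoning
          r≤n : r ≤ length y
          r≤n = ≤-trans (m∸n≤m (length x) j) (≤-reflexive |x|≡|y|)

      preimages⊆orbit : ∀ {x} → x ∈ preimages → x ∈ orbit y
      preimages⊆orbit {x} x∈ with ∈-filter⁻ (λ x → y ≟ʷ minRot x) {xs = allWords k d} x∈
      ... | x∈′ , y≡⟨x⟩ = minRot≡⇒∈orbit x (trans (∈-allWords⁻ x∈′) (sym |y|≡d)) (sym y≡⟨x⟩)

      orbit⊆preimages : ∀ {x} → x ∈ orbit y → x ∈ preimages
      orbit⊆preimages x∈ with ∈-map⁻ (λ i → rotate i y) x∈
      ... | i , i∈ , refl = ∈-filter⁺ (λ x → y ≟ʷ minRot x) (∈-allWords⁺ (trans (length-rotate i y) |y|≡d))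
        (sym (trans (minRot-rotate y i (<-≤-trans (∈-upTo⁻ i∈) (period≤length y 1≤|y|))) sm))

      preimage-count : ∑[ x ∈ allWords k d ] iverson (does (y ≟ʷ minRot x)) 1ℤ ≡ + period y
      preimage-count = begin
        ∑[ x ∈ allWords k d ] iverson (does (y ≟ʷ minRot x)) 1ℤ
          ≡⟨ sym (count≡∑ (λ x → y ≟ʷ minRot x) (allWords k d)) ⟩
        + length preimages
          ≡⟨ ∑-one preimages ⟩
        ∑[ _ ∈ preimages ] 1ℤ
          ≡⟨ ∑-reindexʷ _ _ _ unique (orbit-unique y 1≤|y|) preimages⊆orbit orbit⊆preimages ⟩
        ∑[ _ ∈ orbit y ] 1ℤ
          ≡⟨ sym (∑-one (orbit y)) ⟩
        + length (orbit y)
          ≡⟨ cong +_ (trans (length-map _ (upTo (period y))) (length-upTo (period y))) ⟩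
        + period y ∎
        where
        open ≡-Reasoning
        unique : Unique preimages
        unique = Unique.filter⁺ (λ x → y ≟ʷ minRot x) (allWords-unique d)

    preimage-count : (d : ℕ) (y : Word k) → length y ≡ d → 1 ≤ d →
      ∑[ x ∈ allWords k d ] iverson (does (y ≟ʷ minRot x)) 1ℤ ≡ iverson (isSelfMinimal y) (+ period y)
    preimage-count d y |y|≡d 1≤d with isSelfMinimal y in sm?
    ... | true = Fibre.preimage-count d y |y|≡d 1≤d (isSelfMinimal⇒ y sm?)
    ... | false = ∑-zero (allWords k d) noPreimage
      where
      noPreimage : ∀ x → x ∈ allWords k d → iverson (does (y ≟ʷ minRot x)) 1ℤ ≡ 0ℤ
      noPreimage x _ with y ≟ʷ minRot x
      ... | no _ = refl
      ... | yes refl with trans (sym (isSelfMinimal⇐ (minRot x) (minRot-idempotent x))) sm?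
      ... | ()

    ∑-minRot : (d : ℕ) → 1 ≤ d → (g : Word k → ℤ) →
      ∑[ x ∈ allWords k d ] g (minRot x) ≡ ∑[ y ∈ allWords k d ] iverson (isSelfMinimal y) (+ period y *ℤ g y)
    ∑-minRot d 1≤d g = begin
      ∑[ x ∈ W ] g (minRot x)
        ≡⟨ ∑-cong W (λ x x∈ → sym (∑-selectʷ W (minRot x) g (allWords-unique d) (⟨x⟩∈W x∈))) ⟩
      ∑[ x ∈ W ] ∑[ y ∈ W ] iverson (does (y ≟ʷ minRot x)) (g y)
        ≡⟨ ∑-swap W W _ ⟩
      ∑[ y ∈ W ] ∑[ x ∈ W ] iverson (does (y ≟ʷ minRot x)) (g y)
        ≡⟨ ∑-cong W (λ y y∈ → fibre y (∈-allWords⁻ y∈)) ⟩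
      ∑[ y ∈ W ] iverson (isSelfMinimal y) (+ period y *ℤ g y) ∎
      where
      open ≡-Reasoning
      W = allWords k d
      ⟨x⟩∈W : ∀ {x} → x ∈ W → minRot x ∈ W
      ⟨x⟩∈W {x} x∈ = ∈-allWords⁺ (trans (length-minRot x) (∈-allWords⁻ {n = d} x∈))
      fibre : ∀ y → length y ≡ d →
        ∑[ x ∈ W ] iverson (does (y ≟ʷ minRot x)) (g y) ≡ iverson (isSelfMinimal y) (+ period y *ℤ g y)
      fibre y |y|≡d = begin
        ∑[ x ∈ W ] iverson (does (y ≟ʷ minRot x)) (g y)          ≡⟨ ∑-cong W (λ x _ → scale (does (y ≟ʷ minRot x))) ⟩
        ∑[ x ∈ W ] (g y *ℤ iverson (does (y ≟ʷ minRot x)) 1ℤ)    ≡⟨ ∑-*ˡ W (g y) _ ⟩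
        g y *ℤ ∑[ x ∈ W ] iverson (does (y ≟ʷ minRot x)) 1ℤ      ≡⟨ cong (g y *ℤ_) (preimage-count d y |y|≡d 1≤d) ⟩
        g y *ℤ iverson (isSelfMinimal y) (+ period y)            ≡⟨ iverson-*ˡ (isSelfMinimal y) (g y) _ ⟩
        iverson (isSelfMinimal y) (g y *ℤ + period y)            ≡⟨ cong (iverson _) (ℤP.*-comm (g y) _) ⟩
        iverson (isSelfMinimal y) (+ period y *ℤ g y)            ∎
        where
        scale : ∀ b → iverson b (g y) ≡ g y *ℤ iverson b 1ℤ
        scale b = trans (cong (iverson b) (sym (ℤP.*-identityʳ (g y)))) (sym (iverson-*ˡ b (g y) 1ℤ))

  module _ {k : ℕ} where

    open SetSum (_≟ʷ_ {k}) using () renaming (∑-reindex to ∑-reindexʷ)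

    isLyndon? : (ℓ : Word k) → Dec (isLyndon ℓ ≡ true)
    isLyndon? ℓ = isLyndon ℓ ≟ᵇ true

    lyndonWords : ℕ → List (Word k)
    lyndonWords e = filter isLyndon? (allWords k e)

    ∈-lyndonWords⁻ : ∀ {e ℓ} → ℓ ∈ lyndonWords e → length ℓ ≡ e × isLyndon ℓ ≡ true
    ∈-lyndonWords⁻ {e} ℓ∈ with ∈-filter⁻ isLyndon? {xs = allWords k e} ℓ∈
    ... | ℓ∈′ , lyn = ∈-allWords⁻ ℓ∈′ , lyn

    selfMinimalOfPeriod? : (e : ℕ) (y : Word k) → Dec (e ≡ period y × isSelfMinimal y ≡ true)
    selfMinimalOfPeriod? e y = (e ≟ period y) ×-dec (isSelfMinimal y ≟ᵇ true)

    module PeriodClass (d e : ℕ) (1≤d : 1 ≤ d) (e∈ : e ∈ divisors d) where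

      private
        e∣d : e ∣ d
        e∣d = proj₁ (∈-divisors⁻ d e∈)
        1≤e : 1 ≤ e
        1≤e = proj₂ (∈-divisors⁻ d e∈)
        m = d ÷ e
        m′ = m ∸ 1
        m≡1+m′ : m ≡ suc m′
        m≡1+m′ = ÷-suc 1≤d 1≤e e∣d
        m*e≡d : m * e ≡ d
        m*e≡d = ÷-* 1≤e e∣d

      -- The root of such a y is Lyndon: it has full period and, y being self-minimal, so is it.
      root-lyndon : (y : Word k) → length y ≡ d → period y ≡ e → SelfMinimal y →
                    y ≡ power m (take e y) × isLyndon (take e y) ≡ true
      root-lyndon y |y|≡d refl sm = y≡ℓᵐ , lyndon⇐ ℓ 1≤|ℓ| (trans (period-root y 1≤|y|) (sym |ℓ|)) ℓ-sm
        where
        1≤|y| : 1 ≤ length y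
        1≤|y| = subst (1 ≤_) (sym |y|≡d) 1≤d
        ℓ = take (period y) y
        |ℓ| : length ℓ ≡ period y
        |ℓ| = length-take≤ (period y) y (period≤length y 1≤|y|)
        1≤|ℓ| : 1 ≤ length ℓ
        1≤|ℓ| = subst (1 ≤_) (sym |ℓ|) 1≤e
        y≡ℓᵐ : y ≡ power m ℓ
        y≡ℓᵐ = power-of-fixed m (period y) y (trans |y|≡d (sym m*e≡d)) (rotate-period y 1≤|y|)
        ℓ-sm : SelfMinimal ℓ
        ℓ-sm = selfMinimal-power⇒ ℓ m′ 1≤|ℓ|
                 (subst (λ z → SelfMinimal (power z ℓ)) m≡1+m′ (subst SelfMinimal y≡ℓᵐ sm))

      lyndon-power : (ℓ : Word k) → length ℓ ≡ e → isLyndon ℓ ≡ true →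
                     period (power m ℓ) ≡ e × SelfMinimal (power m ℓ)
      lyndon-power ℓ |ℓ|≡e lyn = subst (λ z → period (power z ℓ) ≡ e × SelfMinimal (power z ℓ)) (sym m≡1+m′)
        (trans (period-power ℓ m′ 1≤|ℓ| (proj₁ full×sm)) |ℓ|≡e , selfMinimal-power⇐ ℓ m′ 1≤|ℓ| (proj₂ full×sm))
        where
        1≤|ℓ| : 1 ≤ length ℓ
        1≤|ℓ| = subst (1 ≤_) (sym |ℓ|≡e) 1≤e
        full×sm : period ℓ ≡ length ℓ × SelfMinimal ℓ
        full×sm = lyndon⇒ ℓ 1≤|ℓ| lyn

      periodClass : List (Word k)
      periodClass = filter (selfMinimalOfPeriod? e) (allWords k d)

      periodClass⊆powers : ∀ {y} → y ∈ periodClass → y ∈ map (power m) (lyndonWords e)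
      periodClass⊆powers {y} y∈ with ∈-filter⁻ (selfMinimalOfPeriod? e) {xs = allWords k d} y∈
      ... | y∈′ , e≡p , sm with root-lyndon y (∈-allWords⁻ y∈′) (sym e≡p) (isSelfMinimal⇒ y sm)
      ... | y≡ℓᵐ , lyn = subst (_∈ map (power m) (lyndonWords e)) (sym y≡ℓᵐ)
            (∈-map⁺ (power m) (∈-filter⁺ isLyndon? (∈-allWords⁺ |ℓ|≡e) lyn))
        where
        |ℓ|≡e : length (take e y) ≡ e
        |ℓ|≡e = length-take≤ e y (subst (_≤ length y) (sym e≡p)
                  (period≤length y (subst (1 ≤_) (sym (∈-allWords⁻ y∈′)) 1≤d)))

      powers⊆periodClass : ∀ {y} → y ∈ map (power m) (lyndonWords e) → y ∈ periodClass
      powers⊆periodClass y∈ with ∈-map⁻ (power m) y∈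
      ... | ℓ , ℓ∈ , refl with ∈-lyndonWords⁻ ℓ∈
      ... | |ℓ|≡e , lyn with lyndon-power ℓ |ℓ|≡e lyn
      ... | p≡e , sm = ∈-filter⁺ (selfMinimalOfPeriod? e)
            (∈-allWords⁺ (trans (length-power m ℓ) (trans (cong (m *_) |ℓ|≡e) m*e≡d)))
            (sym p≡e , isSelfMinimal⇐ (power m ℓ) sm)

      powers-unique : Unique (map (power m) (lyndonWords e))
      powers-unique = map-unique (power m) _ (Unique.filter⁺ isLyndon? (allWords-unique e)) injective
        where
        |ℓ|≡e : ∀ {ℓ} → ℓ ∈ lyndonWords e → length ℓ ≡ e
        |ℓ|≡e ℓ∈ = proj₁ (∈-lyndonWords⁻ ℓ∈)
        injective : ∀ {ℓ ℓ′} → ℓ ∈ lyndonWords e → ℓ′ ∈ lyndonWords e → power m ℓ ≡ power m ℓ′ → ℓ ≡ ℓ′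
        injective ℓ∈ ℓ′∈ ℓᵐ≡ℓ′ᵐ = power-injective m′ _ _ (trans (|ℓ|≡e ℓ∈) (sym (|ℓ|≡e ℓ′∈)))
                                     (subst (λ z → power z _ ≡ power z _) m≡1+m′ ℓᵐ≡ℓ′ᵐ)

      ∑-periodClass : (g : Word k → ℤ) → ∑ periodClass g ≡ ∑[ ℓ ∈ lyndonWords e ] g (power m ℓ)
      ∑-periodClass g = trans
        (∑-reindexʷ _ _ g (Unique.filter⁺ (selfMinimalOfPeriod? e) (allWords-unique d)) powers-unique
                          periodClass⊆powers powers⊆periodClass)
        (∑-map (power m) (lyndonWords e) g)

    ∑-selfMinimal : (d : ℕ) → 1 ≤ d → (g : Word k → ℤ) →
      ∑[ y ∈ allWords k d ] iverson (isSelfMinimal y) (+ period y *ℤ g y) ≡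
      ∑[ e ∈ divisors d ] (+ e *ℤ ∑[ ℓ ∈ lyndonWords e ] g (power (d ÷ e) ℓ))
    ∑-selfMinimal d 1≤d g = begin
      ∑[ y ∈ W ] H y
        ≡⟨ ∑-cong W (λ y y∈ → sym (SetSum.∑-select Data.Nat._≟_ D (period y) (λ _ → H y)
                                                     (divisors-unique d) (period∈D y∈))) ⟩
      ∑[ y ∈ W ] ∑[ e ∈ D ] iverson (does (e ≟ period y)) (H y)
        ≡⟨ ∑-swap W D _ ⟩
      ∑[ e ∈ D ] ∑[ y ∈ W ] iverson (does (e ≟ period y)) (H y)
        ≡⟨ ∑-cong D (λ e e∈ → periodClassSum e e∈) ⟩
      ∑[ e ∈ D ] (+ e *ℤ ∑[ ℓ ∈ lyndonWords e ] g (power (d ÷ e) ℓ)) ∎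
      where
      open ≡-Reasoning
      W = allWords k d
      D = divisors d
      H : Word k → ℤ
      H y = iverson (isSelfMinimal y) (+ period y *ℤ g y)
      period∈D : ∀ {y} → y ∈ W → period y ∈ D
      period∈D {y} y∈ =
        ∈-divisors⁺ {{>-nonZero 1≤d}} (period-pos y 1≤|y|) (subst (period y ∣_) |y|≡d (period-∣ y 1≤|y|))
        where
        |y|≡d : length y ≡ d
        |y|≡d = ∈-allWords⁻ {n = d} y∈
        1≤|y| : 1 ≤ length y
        1≤|y| = subst (1 ≤_) (sym |y|≡d) 1≤d
      weight : ∀ e y → iverson (does (e ≟ period y)) (H y) ≡ + e *ℤ iverson (does (selfMinimalOfPeriod? e y)) (g y)
      weight e y = split (e ≟ period y) (isSelfMinimal y)
        where
        split : (e≟p : Dec (e ≡ period y)) (b : Bool) →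
          iverson (does e≟p) (iverson b (+ period y *ℤ g y)) ≡ + e *ℤ iverson (does (e≟p ×-dec (b ≟ᵇ true))) (g y)
        split (no _) b = sym (ℤP.*-zeroʳ (+ e))
        split (yes e≡p) true rewrite e≡p = refl
        split (yes _) false = sym (ℤP.*-zeroʳ (+ e))
      periodClassSum : ∀ e → e ∈ D →
        ∑[ y ∈ W ] iverson (does (e ≟ period y)) (H y) ≡ + e *ℤ ∑[ ℓ ∈ lyndonWords e ] g (power (d ÷ e) ℓ)
      periodClassSum e e∈ = begin
        ∑[ y ∈ W ] iverson (does (e ≟ period y)) (H y)
          ≡⟨ ∑-cong W (λ y _ → weight e y) ⟩
        ∑[ y ∈ W ] (+ e *ℤ iverson (does (selfMinimalOfPeriod? e y)) (g y))
          ≡⟨ ∑-*ˡ W (+ e) _ ⟩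
        + e *ℤ ∑[ y ∈ W ] iverson (does (selfMinimalOfPeriod? e y)) (g y)
          ≡⟨ cong (+ e *ℤ_) (sym (∑-filter (selfMinimalOfPeriod? e) W g)) ⟩
        + e *ℤ ∑ (PeriodClass.periodClass d e 1≤d e∈) g
          ≡⟨ cong (+ e *ℤ_) (PeriodClass.∑-periodClass d e 1≤d e∈ g) ⟩
        + e *ℤ ∑[ ℓ ∈ lyndonWords e ] g (power (d ÷ e) ℓ) ∎

  module _ {k : ℕ} (w : Word k) (sm : SelfMinimal w) (e : ℕ) (1≤e : 1 ≤ e) where

    private
      n = length w
      p = take e w

    e≤|suffix| : ∀ j → j * e + e ≤ n → e ≤ length (drop (j * e) w)
    e≤|suffix| j je+e≤n rewrite length-drop (j * e) w =
      subst (_≤ n ∸ j * e) (m+n∸n≡m e (j * e)) (∸-monoˡ-≤ (j * e) (subst (_≤ n) (+-comm (j * e) e) je+e≤n))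

    -- The prefix p of length e is below every block of w of length e (w is below its rotations).
    prefix≼block : ∀ j → j * e + e ≤ n → p ≼ take e (drop (j * e) w)
    prefix≼block j je+e≤n = subst (p ≼_) (take-++ˡ e (drop (j * e) w) (take (j * e) w) (e≤|suffix| j je+e≤n))
                                  (≼-take e w _ (selfMinimal⇒ w sm (j * e) je<n))
      where
      je<n : j * e < n
      je<n = <-≤-trans (m<m+n (j * e) 1≤e) je+e≤n

    prefixPower≼ : ∀ m j → (j + m) * e ≤ n → power m p ≼ take (m * e) (drop (j * e) w)
    prefixPower≼ zero j _ = refl
    prefixPower≼ (suc m) j bound rewrite take-+ e (m * e) (drop (j * e) w) with p ≟ʷ take e (drop (j * e) w)
    ... | yes p≡block = subst (λ b → (p ++ power m p) ≼ (b ++ take (m * e) (drop e (drop (j * e) w)))) p≡block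
          (trans (≤ˡᵉˣ-prefix p (power m p) _) (subst (λ r → power m p ≼ take (m * e) r) next-blocks
            (prefixPower≼ m (suc j) (subst (λ z → z * e ≤ n) (+-suc j m) bound))))
      where
      next-blocks : drop (suc j * e) w ≡ drop e (drop (j * e) w)
      next-blocks = trans (cong (λ z → drop z w) (+-comm e (j * e))) (sym (drop-drop (j * e) e w))
    ... | no p≢block = trans (≤ˡᵉˣ-distinctPrefix p _ (power m p) _ |p|≡|block| p≢block) (prefix≼block j je+e≤n)
      where
      je+e≤n : j * e + e ≤ n
      je+e≤n = ≤-trans (≤-reflexive (trans (+-comm (j * e) e) (cong (_* e) (+-comm 1 j))))
                       (≤-trans (*-monoˡ-≤ e (+-monoʳ-≤ j (s≤s (z≤n {m})))) bound)
      |p|≡|block| : length p ≡ length (take e (drop (j * e) w))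
      |p|≡|block| = trans (length-take≤ e w (≤-trans (m≤n+m e (j * e)) je+e≤n)) (sym (length-take≤ e _ (e≤|suffix| j je+e≤n)))

    power≤prefix : ∀ m → suc m * e ≤ n → (ℓ : Word k) → length ℓ ≡ e →
                   power (suc m) ℓ ≤ˡᵉˣ take (suc m * e) w ≡ ℓ ≤ˡᵉˣ p
    power≤prefix m bound ℓ |ℓ|≡e = ⇔→≡ {z = true} (mk⇔ ⇒ ⇐)
      where
      e≤n : e ≤ n
      e≤n = ≤-trans (m≤m+n e (m * e)) bound
      ⇐ : ℓ ≼ p → power (suc m) ℓ ≼ take (suc m * e) w
      ⇐ ℓ≼p = ≼-trans (power (suc m) ℓ) (power (suc m) p) (take (suc m * e) w)
        (power-monotone (suc m) ℓ p (trans |ℓ|≡e (sym (length-take≤ e w e≤n))) ℓ≼p)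
        (prefixPower≼ (suc m) 0 bound)
      ⇒ : power (suc m) ℓ ≼ take (suc m * e) w → ℓ ≼ p
      ⇒ ℓᵐ≼ = subst₂ _≼_ take-ℓᵐ take-prefix (≼-take e _ _ ℓᵐ≼)
        where
        take-ℓᵐ : take e (power (suc m) ℓ) ≡ ℓ
        take-ℓᵐ = subst (λ z → take z (power (suc m) ℓ) ≡ ℓ) |ℓ|≡e (take-power m ℓ)
        take-prefix : take e (take (suc m * e) w) ≡ p
        take-prefix = trans (take-take e (suc m * e) w) (cong (λ z → take z w) (m≤n⇒m⊓n≡m (m≤m+n e (m * e))))

  module _ {k : ℕ} where

    below : Word k → Word k → ℤ
    below w v = iverson (does ((v ≤ˡᵉˣ w) ≟ᵇ true)) 1ℤ

    Lynd≡∑ : (v : Word k) → + Lynd v ≡ ∑[ ℓ ∈ lyndonWords (length v) ] below v ℓ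
    Lynd≡∑ v = begin
      + Lynd v
        ≡⟨ count≡∑ isLyndon? (filter ≤v? W) ⟩
      ∑[ x ∈ filter ≤v? W ] iverson (does (isLyndon? x)) 1ℤ
        ≡⟨ ∑-filter ≤v? W _ ⟩
      ∑[ x ∈ W ] iverson (does (≤v? x)) (iverson (does (isLyndon? x)) 1ℤ)
        ≡⟨ ∑-cong W (λ x _ → iverson-comm (does (≤v? x)) (does (isLyndon? x)) 1ℤ) ⟩
      ∑[ x ∈ W ] iverson (does (isLyndon? x)) (below v x)
        ≡⟨ sym (∑-filter isLyndon? W (below v)) ⟩
      ∑[ ℓ ∈ lyndonWords (length v) ] below v ℓ ∎
      where
      open ≡-Reasoning
      W = allWords k (length v)
      ≤v? : (x : Word k) → Dec ((x ≤ˡᵉˣ v) ≡ true)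
      ≤v? x = (x ≤ˡᵉˣ v) ≟ᵇ true

    module _ (w : Word k) (1≤n : 1 ≤ length w) (sm : SelfMinimal w) where

      private n = length w

      ∑-lyndonPowers : ∀ d e → 1 ≤ d → d ≤ n → e ∈ divisors d →
        ∑[ ℓ ∈ lyndonWords e ] below (take d w) (power (d ÷ e) ℓ) ≡ + Lynd (take e w)
      ∑-lyndonPowers d e 1≤d d≤n e∈ = begin
        ∑[ ℓ ∈ lyndonWords e ] below (take d w) (power (d ÷ e) ℓ)
          ≡⟨ ∑-cong (lyndonWords e) (λ ℓ ℓ∈ → cong (λ b → iverson (does (b ≟ᵇ true)) 1ℤ)
                                                    (powerVsPrefix ℓ (proj₁ (∈-lyndonWords⁻ ℓ∈)))) ⟩
        ∑[ ℓ ∈ lyndonWords e ] below (take e w) ℓ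
          ≡⟨ cong (λ z → ∑[ ℓ ∈ lyndonWords z ] below (take e w) ℓ) (sym |w_e|≡e) ⟩
        ∑[ ℓ ∈ lyndonWords (length (take e w)) ] below (take e w) ℓ
          ≡⟨ sym (Lynd≡∑ (take e w)) ⟩
        + Lynd (take e w) ∎
        where
        open ≡-Reasoning
        e∣d : e ∣ d
        e∣d = proj₁ (∈-divisors⁻ d e∈)
        1≤e : 1 ≤ e
        1≤e = proj₂ (∈-divisors⁻ d e∈)
        m′ = d ÷ e ∸ 1
        m≡1+m′ : d ÷ e ≡ suc m′
        m≡1+m′ = ÷-suc 1≤d 1≤e e∣d
        [1+m′]e≡d : suc m′ * e ≡ d
        [1+m′]e≡d = trans (cong (_* e) (sym m≡1+m′)) (÷-* 1≤e e∣d)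
        |w_e|≡e : length (take e w) ≡ e
        |w_e|≡e = length-take≤ e w (≤-trans (∣⇒≤ {{>-nonZero 1≤d}} e∣d) d≤n)
        powerVsPrefix : ∀ ℓ → length ℓ ≡ e → power (d ÷ e) ℓ ≤ˡᵉˣ take d w ≡ ℓ ≤ˡᵉˣ take e w
        powerVsPrefix ℓ |ℓ|≡e = subst (λ z → power z ℓ ≤ˡᵉˣ take d w ≡ ℓ ≤ˡᵉˣ take e w) (sym m≡1+m′)
          (subst (λ z → power (suc m′) ℓ ≤ˡᵉˣ take z w ≡ ℓ ≤ˡᵉˣ take e w) [1+m′]e≡d
            (power≤prefix w sm e 1≤e m′ (subst (_≤ n) (sym [1+m′]e≡d) d≤n) ℓ |ℓ|≡e))

      cardC-prefix : ∀ d → d ∈ divisors n → + cardC (take d w) ≡ ∑[ e ∈ divisors d ] (+ e *ℤ + Lynd (take e w))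
      cardC-prefix d d∈ = begin
        + cardC v
          ≡⟨ cong (λ z → + length (filter (λ x → (minRot x ≤ˡᵉˣ v) ≟ᵇ true) (allWords k z))) |v|≡d ⟩
        + length (filter (λ x → (minRot x ≤ˡᵉˣ v) ≟ᵇ true) (allWords k d))
          ≡⟨ count≡∑ (λ x → (minRot x ≤ˡᵉˣ v) ≟ᵇ true) (allWords k d) ⟩
        ∑[ x ∈ allWords k d ] below v (minRot x)
          ≡⟨ ∑-minRot d 1≤d (below v) ⟩
        ∑[ y ∈ allWords k d ] iverson (isSelfMinimal y) (+ period y *ℤ below v y)
          ≡⟨ ∑-selfMinimal d 1≤d (below v) ⟩
        ∑[ e ∈ divisors d ] (+ e *ℤ ∑[ ℓ ∈ lyndonWords e ] below v (power (d ÷ e) ℓ))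
          ≡⟨ ∑-cong (divisors d) (λ e e∈ → cong (+ e *ℤ_) (∑-lyndonPowers d e 1≤d d≤n e∈)) ⟩
        ∑[ e ∈ divisors d ] (+ e *ℤ + Lynd (take e w)) ∎
        where
        open ≡-Reasoning
        v = take d w
        1≤d : 1 ≤ d
        1≤d = proj₂ (∈-divisors⁻ n d∈)
        d≤n : d ≤ n
        d≤n = ∣⇒≤ {{>-nonZero 1≤n}} (proj₁ (∈-divisors⁻ n d∈))
        |v|≡d : length v ≡ d
        |v|≡d = length-take≤ d w d≤n

open import Data.Nat using (ℕ; _<_; _/_)
open import Data.Nat.Properties using (≤-refl)
open import Data.Fin using (Fin)
open import Data.List using (List; length; take)
open import Data.List.Properties using (take-all)
open import Data.Integer using (ℤ; +_; _*_)
open import Relation.Binary.PropositionalEquality using (_≡_; refl; sym; cong; module ≡-Reasoning)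
open FiniteSums using (∑)
open Möbius using (divisors; _÷_; sumDivisors≡∑; möbiusInversion)
open Necklaces using (cardC-prefix)

lemma2 : (k : ℕ) (w : List (Fin k)) → 0 < length w → SelfMinimal w →
    + length w * + Lynd w ≡ sumDivisors (length w) (λ d → μ (length w / d) * + cardC (take d w))
lemma2 k w 1≤n sm = sym (begin
  sumDivisors n (λ d → μ (n / d) * + cardC (take d w))
    ≡⟨ sumDivisors≡∑ n (λ d → μ (n / d) * + cardC (take d w)) (λ d → μ (n ÷ d) * + cardC (take d w)) (λ _ → refl) ⟩
  ∑[ d ∈ divisors n ] (μ (n ÷ d) * + cardC (take d w))
    ≡⟨ möbiusInversion n 1≤n (λ e → + e * + Lynd (take e w)) (λ d → + cardC (take d w)) (cardC-prefix w 1≤n sm) ⟩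
  + n * + Lynd (take n w)
    ≡⟨ cong (λ v → + n * + Lynd v) (take-all n w ≤-refl) ⟩
  + n * + Lynd w ∎)
  where
  open ≡-Reasoning
  n = length w
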